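{- If $T$ is a tree of order $n \ge 2$, then $\operatorname{fd}(T) \le n/2$, with equality if and only if $T$ is the corona of a tree.
   Context: All graphs are finite and simple; $N(v)$ denotes the open neighborhood of $v$. The corona of a graph $H$ is the graph of order $2|V(H)|$ obtained from $H$ by attaching a new leaf (pendant vertex) to each vertex of $H$. For a graph $G=(V,E)$ and an integer $k \ge 1$, a $k$-fair dominating set is a dominating set $D \subseteq V$ such that $|N(v) \cap D| = k$ for every $v \in V \setminus D$ (the set $D = V$ qualifies vacuously). A fair dominating set (FD-set) is a set that is a $k$-fair dominating set for some $k \ge 1$. If $G$ has at least one edge, $\operatorname{fd}(G)$ is the minimum cardinality of an FD-set of $G$; by convention, $\operatorname{fd}(\overline{K_n}) = n$. -}

module Defs where

open import Data.Nat using (ℕ; zero; suc; _+_; _≤_)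
open import Data.Bool using (Bool; true; false; _∧_)
open import Data.Fin using (Fin; splitAt; _≟_)
open import Data.Fin.Subset using (Subset; _∈_; _∉_; ∣_∣)
open import Data.Vec using (tabulate; lookup)
open import Data.Sum using (_⊎_; inj₁; inj₂)
open import Data.Product using (Σ; _×_; _,_)
open import Data.List using (List; []; _∷_; _++_; length)
open import Data.List.Relation.Unary.Linked using (Linked)
open import Data.List.Relation.Unary.Unique.Propositional using (Unique)
open import Relation.Nullary using (¬_; does; yes; no)
open import Relation.Binary.PropositionalEquality using (_≡_; refl; sym)
open import Function.Bundles using (_↔_; Inverse)

record Graph (n : ℕ) : Set where
  field
    adj    : Fin n → Fin n → Bool
    symm   : ∀ u v → adj u v ≡ adj v u
    irrefl : ∀ v → adj v v ≡ false
open Graph public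

Adj : ∀ {n} → Graph n → Fin n → Fin n → Set
Adj G u v = adj G u v ≡ true

data Walk {n : ℕ} (G : Graph n) : Fin n → Fin n → Set where
  here : ∀ {u} → Walk G u u
  step : ∀ {u v w} → Adj G u v → Walk G v w → Walk G u w

Connected : ∀ {n} → Graph n → Set
Connected G = ∀ u v → Walk G u v

HasCycle : ∀ {n} → Graph n → Set
HasCycle {n} G =
  Σ (Fin n) λ u → Σ (List (Fin n)) λ vs →
    (2 ≤ length vs) × Unique (u ∷ vs) × Linked (Adj G) (u ∷ vs ++ u ∷ [])

Acyclic : ∀ {n} → Graph n → Set
Acyclic G = ¬ HasCycle G

IsTree : ∀ {n} → Graph n → Set
IsTree {n} G = (1 ≤ n) × Connected G × Acyclic G

nbrsIn : ∀ {n} → Graph n → Subset n → Fin n → ℕ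
nbrsIn G D v = ∣ tabulate (λ u → adj G v u ∧ lookup D u) ∣

IsDominating : ∀ {n} → Graph n → Subset n → Set
IsDominating {n} G D = ∀ v → v ∉ D → Σ (Fin n) λ u → (u ∈ D) × Adj G v u

IsKFairDominating : ∀ {n} → Graph n → ℕ → Subset n → Set
IsKFairDominating G k D =
  IsDominating G D × (∀ v → v ∉ D → nbrsIn G D v ≡ k)

IsFDSet : ∀ {n} → Graph n → Subset n → Set
IsFDSet G D = Σ ℕ λ k → (1 ≤ k) × IsKFairDominating G k D

-- m is fd(G): the minimum cardinality of an FD-set
-- (only used for graphs with at least one edge, e.g. trees of order ≥ 2)
IsFd : ∀ {n} → Graph n → ℕ → Set
IsFd {n} G m =
  (Σ (Subset n) λ D → IsFDSet G D × ∣ D ∣ ≡ m) ×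
  (∀ D → IsFDSet G D → m ≤ ∣ D ∣)

-- the corona of a graph H on Fin k, with vertex set Fin (k + k):
-- the first copy is H, vertex k+i is a leaf attached to i
private
  dec≡sym : ∀ {k} (i j : Fin k) → does (i ≟ j) ≡ does (j ≟ i)
  dec≡sym i j with i ≟ j | j ≟ i
  ... | yes _ | yes _ = refl
  ... | no _  | no _  = refl
  ... | yes p | no q  with q (sym p)
  ... | ()
  dec≡sym i j | no q | yes p with q (sym p)
  ... | ()

  dec≡refl : ∀ {k} (i : Fin k) → does (i ≟ i) ≡ true
  dec≡refl i with i ≟ i
  ... | yes _ = refl
  ... | no q with q refl
  ... | ()

coronaAdj⊎ : ∀ {k} → Graph k → Fin k ⊎ Fin k → Fin k ⊎ Fin k → Bool
coronaAdj⊎ H (inj₁ i) (inj₁ j) = adj H i j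
coronaAdj⊎ H (inj₁ i) (inj₂ j) = does (i ≟ j)
coronaAdj⊎ H (inj₂ i) (inj₁ j) = does (i ≟ j)
coronaAdj⊎ H (inj₂ i) (inj₂ j) = false

private
  coronaSym⊎ : ∀ {k} (H : Graph k) x y → coronaAdj⊎ H x y ≡ coronaAdj⊎ H y x
  coronaSym⊎ H (inj₁ i) (inj₁ j) = symm H i j
  coronaSym⊎ H (inj₁ i) (inj₂ j) = dec≡sym i j
  coronaSym⊎ H (inj₂ i) (inj₁ j) = dec≡sym i j
  coronaSym⊎ H (inj₂ i) (inj₂ j) = refl

  coronaIrr⊎ : ∀ {k} (H : Graph k) x → coronaAdj⊎ H x x ≡ false
  coronaIrr⊎ H (inj₁ i) = irrefl H i
  coronaIrr⊎ H (inj₂ i) = refl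

corona : ∀ {k} → Graph k → Graph (k + k)
corona {k} H = record
  { adj    = λ u v → coronaAdj⊎ H (splitAt k u) (splitAt k v)
  ; symm   = λ u v → coronaSym⊎ H (splitAt k u) (splitAt k v)
  ; irrefl = λ v → coronaIrr⊎ H (splitAt k v)
  }

_≅_ : ∀ {n m} → Graph n → Graph m → Set
_≅_ {n} {m} G H = Σ (Fin n ↔ Fin m) λ f →
  ∀ u v → adj G u v ≡ adj H (Inverse.to f u) (Inverse.to f v)

IsCoronaOfTree : ∀ {n} → Graph n → Set
IsCoronaOfTree G = Σ ℕ λ k → Σ (Graph k) λ H → IsTree H × (G ≅ corona H)

-- Call a set D of vertices of a subtree S perfect if every vertex of S outside D has exactly
-- one neighbour in D. By induction on |S| ≥ 2, either every vertex of S is a leaf or adjacent to exactly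
-- one leaf (S is corona-like, and then some perfect set has at most |S|/2 elements), or S has a perfect
-- set D with 2|D| < |S|. For the induction take a star (its centre alone is perfect) or the last vertices
-- x0 x1 x2 x3 of a longest path: if x1 carries a second leaf, delete all leaves at x1; if x1 has degree 2
-- and x2 does not, delete x0 and x1; if both have degree 2, delete x0, x1 and x2 unless S is that path.
-- A perfect set of the rest, extended by x0 or x1 when needed, is small enough for S, and a corona-like
-- rest in the second case makes S corona-like. Perfect sets are 1-fair, so fd(T) ≤ n/2, with equality
-- only for coronas; conversely every dominating set of a corona contains each leaf or its neighbour.

module Submission where

open import Defs
open import Data.Nat using (ℕ; zero; suc; _+_; _*_; _≤_; _<_; z≤n; s≤s; _≡ᵇ_)
open import Data.Nat.Properties
  using (≤-refl; ≤-reflexive; ≤-trans; ≤-antisym; ≤-pred; <⇒≤; <⇒≱; ≤-<-trans; <-trans; n≤1+n;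
         m≤n⇒m≤1+n; m≤n⇒m<n∨m≡n; suc-injective; +-identityʳ; +-suc; +-mono-≤; +-monoˡ-≤; +-monoʳ-≤;
         *-suc; *-monoʳ-≤; +-commutativeSemigroup; module ≤-Reasoning)
open import Data.Nat.Induction using (<-rec)
open import Data.Bool using (Bool; true; false; _∧_; _∨_; not)
open import Data.Bool.Properties using (∧-zeroʳ; ∧-identityʳ; ∨-identityʳ)
import Data.Bool.Properties as Bool
open import Data.Fin using (Fin; zero; suc; _≟_; splitAt; join)
open import Data.Fin.Properties
  using (any?; injective⇒≤; splitAt-join; join-splitAt; cantor-schröder-bernstein)
open import Data.Fin.Subset using (Subset; _∈_; _∉_; ∣_∣)
open import Data.Vec using (tabulate; lookup)
open import Data.Vec.Properties using (lookup∘tabulate; tabulate∘lookup; lookup⇒[]=; []=⇒lookup)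
open import Data.List using (List; []; _∷_; _++_; length; map)
open import Data.List.Properties using (++-assoc; map-++; length-map)
open import Data.List.Relation.Unary.All as All using (All; []; _∷_)
open import Data.List.Relation.Unary.All.Properties using (¬Any⇒All¬; All¬⇒¬Any; ++⁻ˡ)
open import Data.List.Relation.Unary.AllPairs using ([]; _∷_)
import Data.List.Relation.Unary.Any as Any
open import Data.List.Relation.Unary.Linked as Linked using (Linked; []; [-]; _∷_)
import Data.List.Relation.Unary.Linked.Properties as Linkedₚ
open import Data.List.Relation.Unary.Unique.Propositional using (Unique)
import Data.List.Relation.Unary.Unique.Propositional.Properties as Uniqueₚ
import Data.List.Membership.Propositional as List
open import Data.List.Membership.Propositional.Properties using (∈-∃++)
open import Data.Product using (Σ; _×_; _,_; proj₁; proj₂)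
open import Data.Sum using (_⊎_; inj₁; inj₂; [_,_]; [_,_]′)
import Data.Sum as Sum
import Data.Sum.Properties as Sumₚ
open import Data.Empty using (⊥; ⊥-elim)
open import Relation.Nullary using (¬_; Dec; yes; no; does; ¬?; _×-dec_)
open import Relation.Nullary.Decidable using (dec-true; dec-false; decidable-stable; toSum)
open import Relation.Binary.PropositionalEquality
  using (_≡_; refl; sym; trans; cong; cong₂; subst; subst₂)
open import Function using (_∘_; id)
open import Function.Bundles using (_↔_; _⇔_; Inverse; mk↔ₛ′; mk⇔)
open import Algebra.Properties.CommutativeSemigroup +-commutativeSemigroup using (interchange)

∧-intro : ∀ {a b} → a ≡ true → b ≡ true → (a ∧ b) ≡ true
∧-intro refl refl = refl

∧-elimˡ : ∀ {a b} → (a ∧ b) ≡ true → a ≡ true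
∧-elimˡ {true} _ = refl

∧-elimʳ : ∀ {a b} → (a ∧ b) ≡ true → b ≡ true
∧-elimʳ {true} h = h

∧-falseʳ : ∀ {a b} → (a ∧ b) ≡ false → a ≡ true → b ≡ false
∧-falseʳ h refl = h

not-true : ∀ {a} → not a ≡ true → a ≡ false
not-true {false} _ = refl

not-false : ∀ {a} → not a ≡ false → a ≡ true
not-false {true} _ = refl

false⇒not : ∀ {a} → a ≡ false → not a ≡ true
false⇒not refl = refl

∧-congˡ-true : ∀ {a c} b → (b ≡ true → a ≡ c) → (a ∧ b) ≡ (c ∧ b)
∧-congˡ-true {a} {c} true  eq = trans (∧-identityʳ a) (trans (eq refl) (sym (∧-identityʳ c)))
∧-congˡ-true {a} {c} false eq = trans (∧-zeroʳ a) (sym (∧-zeroʳ c))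

∧-congʳ-true : ∀ a {b c} → (a ≡ true → b ≡ c) → (a ∧ b) ≡ (a ∧ c)
∧-congʳ-true true  eq = eq refl
∧-congʳ-true false eq = refl

true≢false : ¬ true ≡ false
true≢false ()

¬true⇒false : ∀ {b} → ¬ b ≡ true → b ≡ false
¬true⇒false {false} _ = refl
¬true⇒false {true}  h = ⊥-elim (h refl)

true-irrelevant : ∀ {b} (p q : b ≡ true) → p ≡ q
true-irrelevant refl refl = refl


_==_ : ∀ {n} → Fin n → Fin n → Bool
x == y = does (x ≟ y)

==-refl : ∀ {n} (x : Fin n) → (x == x) ≡ true
==-refl x = dec-true (x ≟ x) refl

≢⇒==-false : ∀ {n} {x y : Fin n} → ¬ x ≡ y → (x == y) ≡ false
≢⇒==-false {x = x} {y} = dec-false (x ≟ y)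

==⇒≡ : ∀ {n} {x y : Fin n} → (x == y) ≡ true → x ≡ y
==⇒≡ {x = x} {y} h with x ≟ y
... | yes x≡y = x≡y

==-false⇒≢ : ∀ {n} {x y : Fin n} → (x == y) ≡ false → ¬ x ≡ y
==-false⇒≢ {x = x} h refl with () ← trans (sym h) (==-refl x)

VertexSet : ℕ → Set
VertexSet n = Fin n → Bool

module _ {n : ℕ} where

  _⊆_ : VertexSet n → VertexSet n → Set
  D ⊆ S = ∀ {x} → D x ≡ true → S x ≡ true

  _─_ : VertexSet n → VertexSet n → VertexSet n
  (S ─ R) x = S x ∧ not (R x)

  _∖_ : VertexSet n → Fin n → VertexSet n
  S ∖ x = S ─ (_== x)

  insert : Fin n → VertexSet n → VertexSet n
  insert x D y = D y ∨ (y == x)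

  ─-∈ : ∀ {S R : VertexSet n} {x} → S x ≡ true → R x ≡ false → (S ─ R) x ≡ true
  ─-∈ Sx Rx = ∧-intro Sx (false⇒not Rx)

  ─-⊆ : ∀ {S R : VertexSet n} → (S ─ R) ⊆ S
  ─-⊆ = ∧-elimˡ

  ─-∉ : ∀ {S R : VertexSet n} {x} → S x ≡ true → (S ─ R) x ≡ false → R x ≡ true
  ─-∉ Sx h = not-false (∧-falseʳ h Sx)

  ∖-∈ : ∀ {S : VertexSet n} {x v} → S v ≡ true → ¬ v ≡ x → (S ∖ x) v ≡ true
  ∖-∈ {S} {x} Sv v≢x = ─-∈ {S} {_== x} Sv (≢⇒==-false v≢x)

  ∖-≢ : ∀ {S : VertexSet n} {x v} → (S ∖ x) v ≡ true → ¬ v ≡ x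
  ∖-≢ {S} {v = v} h = ==-false⇒≢ (not-true (∧-elimʳ {S v} h))

  ∖-∉ : ∀ (S : VertexSet n) x → (S ∖ x) x ≡ false
  ∖-∉ S x rewrite ==-refl x = ∧-zeroʳ (S x)

  ∖-≡ : ∀ (S : VertexSet n) {x v} → ¬ v ≡ x → (S ∖ x) v ≡ S v
  ∖-≡ S {v = v} v≢x rewrite ≢⇒==-false v≢x = ∧-identityʳ (S v)

  insert-∈ : ∀ x (D : VertexSet n) → insert x D x ≡ true
  insert-∈ x D rewrite ==-refl x with D x
  ... | true  = refl
  ... | false = refl

  insert-⊇ : ∀ {x} {D : VertexSet n} → D ⊆ insert x D
  insert-⊇ Dy rewrite Dy = refl

  insert-∈⁻ : ∀ {x} (D : VertexSet n) {y} → insert x D y ≡ true → D y ≡ true ⊎ y ≡ x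
  insert-∈⁻ D {y} h with D y
  ... | true  = inj₁ refl
  ... | false = inj₂ (==⇒≡ h)

  insert-⊆ : ∀ {x} {D S : VertexSet n} → D ⊆ S → S x ≡ true → insert x D ⊆ S
  insert-⊆ {D = D} D⊆S Sx {y} h with insert-∈⁻ D {y} h
  ... | inj₁ Dy   = D⊆S Dy
  ... | inj₂ refl = Sx

  insert-∉⁻ : ∀ {x} (D : VertexSet n) {y} → insert x D y ≡ false → D y ≡ false
  insert-∉⁻ D {y} h with D y
  ... | false = refl

  insert-∉ : ∀ {x} {D : VertexSet n} {y} → D y ≡ false → ¬ y ≡ x → insert x D y ≡ false
  insert-∉ Dy y≢x rewrite Dy = ≢⇒==-false y≢x

  insert-∉⇒≢ : ∀ {x} (D : VertexSet n) {y} → insert x D y ≡ false → ¬ y ≡ x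
  insert-∉⇒≢ {x} D h refl with () ← trans (sym h) (insert-∈ x D)

  ⊆-∉ : ∀ {D S : VertexSet n} → D ⊆ S → ∀ {x} → S x ≡ false → D x ≡ false
  ⊆-∉ D⊆S Sx = ¬true⇒false λ Dx → true≢false (trans (sym (D⊆S Dx)) Sx)

-- Counting and enumerating vertex sets

toℕ : Bool → ℕ
toℕ true  = 1
toℕ false = 0

count : ∀ {n} → VertexSet n → ℕ
count {zero}  f = 0
count {suc n} f = toℕ (f zero) + count (f ∘ suc)

find : ∀ {n} (f : VertexSet n) → (Σ (Fin n) λ x → f x ≡ true) ⊎ (∀ x → f x ≡ false)
find {zero}  f = inj₂ λ ()
find {suc n} f with f zero in f0 | find (f ∘ suc)
... | true  | _              = inj₁ (zero , f0)
... | false | inj₁ (x , fx)  = inj₁ (suc x , fx)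
... | false | inj₂ none      = inj₂ λ { zero → f0 ; (suc x) → none x }

count-cong : ∀ {n} {f g : VertexSet n} → (∀ x → f x ≡ g x) → count f ≡ count g
count-cong {zero}  eq = refl
count-cong {suc n} eq = cong₂ _+_ (cong toℕ (eq zero)) (count-cong (eq ∘ suc))

count-mono : ∀ {n} {f g : VertexSet n} → (∀ x → f x ≡ true → g x ≡ true) → count f ≤ count g
count-mono {zero}          f⊆g = z≤n
count-mono {suc n} {f} {g} f⊆g = +-mono-≤ (toℕ-mono (f⊆g zero)) (count-mono (f⊆g ∘ suc))
  where
  toℕ-mono : ∀ {a b} → (a ≡ true → b ≡ true) → toℕ a ≤ toℕ b
  toℕ-mono {true}  a⇒b rewrite a⇒b refl = ≤-refl
  toℕ-mono {false} a⇒b = z≤n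

count-none : ∀ {n} {f : VertexSet n} → (∀ x → f x ≡ false) → count f ≡ 0
count-none {zero}  none = refl
count-none {suc n} none rewrite none zero = count-none (none ∘ suc)

count≤n : ∀ {n} (f : VertexSet n) → count f ≤ n
count≤n {zero}  f = z≤n
count≤n {suc n} f with f zero
... | true  = s≤s (count≤n (f ∘ suc))
... | false = m≤n⇒m≤1+n (count≤n (f ∘ suc))

count-true : ∀ n → count {n} (λ _ → true) ≡ n
count-true zero    = refl
count-true (suc n) = cong suc (count-true n)

count-split : ∀ {n} (f g : VertexSet n) → count f ≡ count (λ x → f x ∧ g x) + count (f ─ g)
count-split {zero}  f g = refl
count-split {suc n} f g =
  trans (cong₂ _+_ (toℕ-split (f zero) (g zero)) (count-split (f ∘ suc) (g ∘ suc)))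
        (interchange (toℕ (f zero ∧ g zero)) (toℕ (f zero ∧ not (g zero))) _ _)
  where
  toℕ-split : ∀ a b → toℕ a ≡ toℕ (a ∧ b) + toℕ (a ∧ not b)
  toℕ-split true  true  = refl
  toℕ-split true  false = refl
  toℕ-split false b     = refl

count-singleton : ∀ {n} (x : Fin n) → count (_== x) ≡ 1
count-singleton {suc n} zero    = cong suc (count-none {n} λ _ → refl)
count-singleton {suc n} (suc x) = count-singleton x

count-remove : ∀ {n} (f : VertexSet n) {x} → f x ≡ true → count f ≡ suc (count (f ∖ x))
count-remove f {x} fx =
  trans (count-split f (_== x)) (cong (_+ count (f ∖ x)) (trans (count-cong only-x) (count-singleton x)))
  where
  only-x : ∀ y → (f y ∧ (y == x)) ≡ (y == x)
  only-x y with y == x in y=x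
  ... | true  = trans (∧-identityʳ (f y)) (subst (λ z → f z ≡ true) (sym (==⇒≡ y=x)) fx)
  ... | false = ∧-zeroʳ (f y)

count-insert : ∀ {n} (f : VertexSet n) {x} → f x ≡ false → count (insert x f) ≡ suc (count f)
count-insert f {x} fx = trans (count-remove (insert x f) (insert-∈ x f)) (cong suc (count-cong remove-x))
  where
  remove-x : ∀ y → ((f y ∨ (y == x)) ∧ not (y == x)) ≡ f y
  remove-x y with y == x in y=x
  ... | true  = trans (∧-zeroʳ _) (sym (subst (λ z → f z ≡ false) (sym (==⇒≡ y=x)) fx))
  ... | false = trans (∧-identityʳ _) (∨-identityʳ (f y))

∈⇒1≤count : ∀ {n} (f : VertexSet n) {x} → f x ≡ true → 1 ≤ count f
∈⇒1≤count f fx rewrite count-remove f fx = s≤s z≤n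

1≤count⇒∈ : ∀ {n} (f : VertexSet n) → 1 ≤ count f → Σ (Fin n) λ x → f x ≡ true
1≤count⇒∈ f 1≤ with find f
... | inj₁ found = found
... | inj₂ none with () ← subst (1 ≤_) (count-none none) 1≤

two-∈⇒2≤count : ∀ {n} (f : VertexSet n) {x y} → ¬ x ≡ y → f x ≡ true → f y ≡ true →
  2 ≤ count f
two-∈⇒2≤count f {x} x≢y fx fy rewrite count-remove f fx =
  s≤s (∈⇒1≤count (f ∖ x) (∖-∈ {S = f} fy (x≢y ∘ sym)))

three-∈⇒3≤count : ∀ {n} (f : VertexSet n) {x y z} → ¬ x ≡ y → ¬ x ≡ z → ¬ y ≡ z →
  f x ≡ true → f y ≡ true → f z ≡ true → 3 ≤ count f
three-∈⇒3≤count f {x} x≢y x≢z y≢z fx fy fz rewrite count-remove f fx =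
  s≤s (two-∈⇒2≤count (f ∖ x) y≢z (∖-∈ {S = f} fy (x≢y ∘ sym))
                                  (∖-∈ {S = f} fz (x≢z ∘ sym)))

count≡1⇒unique : ∀ {n} (f : VertexSet n) → count f ≡ 1 →
  ∀ {x y} → f x ≡ true → f y ≡ true → x ≡ y
count≡1⇒unique f eq {x} {y} fx fy with x ≟ y
... | yes x≡y = x≡y
... | no  x≢y with s≤s () ← subst (2 ≤_) eq (two-∈⇒2≤count f x≢y fx fy)

unique⇒count≡1 : ∀ {n} (f : VertexSet n) {w} → f w ≡ true → (∀ y → f y ≡ true → y ≡ w) →
  count f ≡ 1
unique⇒count≡1 f {w} fw only = trans (count-remove f fw) (cong suc (count-none others))
  where
  others : ∀ y → (f ∖ w) y ≡ false
  others y with f y in fy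
  ... | false = refl
  ... | true rewrite only y fy | ==-refl w = refl

count≡2⇒unique-other : ∀ {n} (f : VertexSet n) → count f ≡ 2 → ∀ {a b c} → f a ≡ true →
  f b ≡ true → f c ≡ true → ¬ b ≡ a → ¬ c ≡ a → b ≡ c
count≡2⇒unique-other f eq {a} fa fb fc b≢a c≢a =
  count≡1⇒unique (f ∖ a) (suc-injective (trans (sym (count-remove f fa)) eq))
    (∖-∈ {S = f} fb b≢a) (∖-∈ {S = f} fc c≢a)

private
  enum-cons : ∀ {n c} (b : Bool) → (Fin c → Fin n) → Fin (toℕ b + c) → Fin (suc n)
  enum-cons true  g zero    = zero
  enum-cons true  g (suc i) = suc (g i)
  enum-cons false g i       = suc (g i)

  index-head : ∀ {c} (b : Bool) → b ≡ true → Fin (toℕ b + c)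
  index-head true _ = zero

  index-shift : ∀ {c} (b : Bool) → Fin c → Fin (toℕ b + c)
  index-shift true  i = suc i
  index-shift false i = i

enum : ∀ {n} (f : VertexSet n) → Fin (count f) → Fin n
enum {suc n} f = enum-cons (f zero) (enum (f ∘ suc))

index : ∀ {n} (f : VertexSet n) x → f x ≡ true → Fin (count f)
index {suc n} f zero    fx = index-head (f zero) fx
index {suc n} f (suc x) fx = index-shift (f zero) (index (f ∘ suc) x fx)

enum-∈ : ∀ {n} (f : VertexSet n) i → f (enum f i) ≡ true
enum-∈ {suc n} f = go (f zero) refl
  where
  go : ∀ b → f zero ≡ b → (i : Fin (toℕ b + count (f ∘ suc))) →
       f (enum-cons b (enum (f ∘ suc)) i) ≡ true
  go true  f0 zero    = f0
  go true  f0 (suc i) = enum-∈ (f ∘ suc) i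
  go false f0 i       = enum-∈ (f ∘ suc) i

enum-index : ∀ {n} (f : VertexSet n) x fx → enum f (index f x fx) ≡ x
enum-index {suc n} f zero fx = go (f zero) fx
  where
  go : ∀ b (h : b ≡ true) →
       enum-cons {c = count (f ∘ suc)} b (enum (f ∘ suc)) (index-head b h) ≡ zero
  go true _ = refl
enum-index {suc n} f (suc x) fx = go (f zero)
  where
  go : ∀ b → enum-cons b (enum (f ∘ suc)) (index-shift b (index (f ∘ suc) x fx)) ≡ suc x
  go true  = cong suc (enum-index (f ∘ suc) x fx)
  go false = cong suc (enum-index (f ∘ suc) x fx)

index-enum : ∀ {n} (f : VertexSet n) i fi → index f (enum f i) fi ≡ i
index-enum {suc n} f i fi = go (f zero) refl i fi
  where
  go : ∀ b (f0 : f zero ≡ b) (i : Fin (toℕ b + count (f ∘ suc)))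
       (fi : f (enum-cons b (enum (f ∘ suc)) i) ≡ true) →
       subst (λ b → Fin (toℕ b + count (f ∘ suc))) f0
             (index f (enum-cons b (enum (f ∘ suc)) i) fi) ≡ i
  go true f0 zero fi with f zero | f0
  ... | .true | refl with fi
  ... | refl = refl
  go true f0 (suc i) fi with f zero | f0
  ... | .true | refl = cong suc (index-enum (f ∘ suc) i fi)
  go false f0 i fi with f zero | f0
  ... | .false | refl = index-enum (f ∘ suc) i fi

index-cong : ∀ {n} (f : VertexSet n) {x y} (x≡y : x ≡ y) fx fy → index f x fx ≡ index f y fy
index-cong f {x} refl fx fy = cong (index f x) (true-irrelevant fx fy)

index-injective : ∀ {n} (f : VertexSet n) {x y} fx fy → index f x fx ≡ index f y fy → x ≡ y
index-injective f {x} {y} fx fy eq =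
  trans (sym (enum-index f x fx)) (trans (cong (enum f) eq) (enum-index f y fy))

enum-injective : ∀ {n} (f : VertexSet n) {i j} → enum f i ≡ enum f j → i ≡ j
enum-injective f {i} {j} eq =
  trans (sym (index-enum f i (enum-∈ f i)))
        (trans (index-cong f eq (enum-∈ f i) (enum-∈ f j)) (index-enum f j (enum-∈ f j)))

injection⇒≤count : ∀ {n k} (f : VertexSet n) (g : Fin k → Fin n) → (∀ i → f (g i) ≡ true) →
  (∀ {i j} → g i ≡ g j → i ≡ j) → k ≤ count f
injection⇒≤count f g g∈ g-inj =
  injective⇒≤ {f = λ i → index f (g i) (g∈ i)} (λ eq → g-inj (index-injective f (g∈ _) (g∈ _) eq))

count-mono-injective : ∀ {n m} (f : VertexSet n) (g : VertexSet m) (φ : Fin n → Fin m) →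
  (∀ {x} → f x ≡ true → g (φ x) ≡ true) →
  (∀ {x y} → f x ≡ true → f y ≡ true → φ x ≡ φ y → x ≡ y) → count f ≤ count g
count-mono-injective f g φ φ∈ φ-inj =
  injection⇒≤count g (φ ∘ enum f) (λ i → φ∈ (enum-∈ f i))
    (λ eq → enum-injective f (φ-inj (enum-∈ f _) (enum-∈ f _) eq))

∣tabulate∣≡count : ∀ {n} (f : VertexSet n) → ∣ tabulate f ∣ ≡ count f
∣tabulate∣≡count {zero}  f = refl
∣tabulate∣≡count {suc n} f with f zero
... | true  = cong suc (∣tabulate∣≡count (f ∘ suc))
... | false = ∣tabulate∣≡count (f ∘ suc)

-- Neighbourhoods and walks inside vertex sets

another-∈ : ∀ {n} (f : VertexSet n) {a} → f a ≡ true → 2 ≤ count f →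
  Σ (Fin n) λ b → f b ≡ true × ¬ b ≡ a
another-∈ f {a} fa 2≤ with 1≤count⇒∈ (f ∖ a) (≤-pred (subst (2 ≤_) (count-remove f fa) 2≤))
... | b , h = b , ∧-elimˡ h , ∖-≢ {S = f} h

module Neighbourhood {n : ℕ} (G : Graph n) where

  infix 4 _~_
  _~_ : Fin n → Fin n → Set
  u ~ v = Adj G u v

  ~-sym : ∀ {u v} → u ~ v → v ~ u
  ~-sym {u} {v} u~v = trans (symm G v u) u~v

  ~⇒≢ : ∀ {u v} → u ~ v → ¬ u ≡ v
  ~⇒≢ {u} u~u refl with () ← trans (sym (irrefl G u)) u~u

  nbr : VertexSet n → Fin n → VertexSet n
  nbr S v w = S w ∧ adj G v w

  degree : VertexSet n → Fin n → ℕ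
  degree S v = count (nbr S v)

  isLeaf : VertexSet n → Fin n → Bool
  isLeaf S v = degree S v ≡ᵇ 1

  Pendant : VertexSet n → Fin n → Fin n → Set
  Pendant S v w = ∀ {z} → S z ≡ true → v ~ z → z ≡ w

  isLeaf⇒degree≡1 : ∀ {S v} → isLeaf S v ≡ true → degree S v ≡ 1
  isLeaf⇒degree≡1 {S} {v} = go (degree S v)
    where
    go : ∀ d → (d ≡ᵇ 1) ≡ true → d ≡ 1
    go 1 _ = refl

  2≤degree⇒¬isLeaf : ∀ {S v} → 2 ≤ degree S v → isLeaf S v ≡ false
  2≤degree⇒¬isLeaf {S} {v} = go (degree S v)
    where
    go : ∀ d → 2 ≤ d → (d ≡ᵇ 1) ≡ false
    go (suc (suc d)) _         = refl
    go (suc zero)    (s≤s ())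

  pendant⇒degree≡1 : ∀ {S v w} → S w ≡ true → v ~ w → Pendant S v w → degree S v ≡ 1
  pendant⇒degree≡1 {S} {v} Sw v~w only =
    unique⇒count≡1 (nbr S v) (∧-intro Sw v~w) (λ y h → only (∧-elimˡ h) (∧-elimʳ {S y} h))

  pendant⇒isLeaf : ∀ {S v w} → S w ≡ true → v ~ w → Pendant S v w → isLeaf S v ≡ true
  pendant⇒isLeaf Sw v~w only rewrite pendant⇒degree≡1 Sw v~w only = refl

  pendant-by-elimination : ∀ {S D v a b} → D ⊆ S → (∀ {y} → S y ≡ true → v ~ y → y ≡ a ⊎ y ≡ b) →
    D a ≡ false → Pendant D v b
  pendant-by-elimination {D = D} D⊆S nbrs Da Dy v~y with nbrs (D⊆S Dy) v~y
  ... | inj₁ refl = ⊥-elim (true≢false (trans (sym Dy) Da))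
  ... | inj₂ y≡b  = y≡b

  partner : VertexSet n → Fin n → Fin n
  partner S v with find (nbr S v)
  ... | inj₁ (w , _) = w
  ... | inj₂ _       = v

  partner-spec : ∀ {S v} → isLeaf S v ≡ true →
    S (partner S v) ≡ true × v ~ partner S v × Pendant S v (partner S v)
  partner-spec {S} {v} leaf with find (nbr S v)
  ... | inj₁ (w , h) = ∧-elimˡ h , ∧-elimʳ {S w} h ,
                       λ Sz v~z → count≡1⇒unique (nbr S v) (isLeaf⇒degree≡1 leaf) (∧-intro Sz v~z) h
  ... | inj₂ none with () ← trans (sym (count-none none)) (isLeaf⇒degree≡1 {S} leaf)

  partner-∈ : ∀ {S v} → isLeaf S v ≡ true → S (partner S v) ≡ true
  partner-∈ = proj₁ ∘ partner-spec

  partner-~ : ∀ {S v} → isLeaf S v ≡ true → v ~ partner S v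
  partner-~ = proj₁ ∘ proj₂ ∘ partner-spec

  partner-pendant : ∀ {S v} → isLeaf S v ≡ true → Pendant S v (partner S v)
  partner-pendant = proj₂ ∘ proj₂ ∘ partner-spec

  data WalkIn (S : VertexSet n) : Fin n → Fin n → Set where
    here : ∀ {u} → WalkIn S u u
    step : ∀ {u v w} → u ~ v → S v ≡ true → WalkIn S v w → WalkIn S u w

  ConnectedIn : VertexSet n → Set
  ConnectedIn S = ∀ {u v} → S u ≡ true → S v ≡ true → WalkIn S u v

  full : VertexSet n
  full _ = true

  Connected⇒ConnectedIn-full : Connected G → ConnectedIn full
  Connected⇒ConnectedIn-full conn {u} {v} _ _ = lift (conn u v)
    where
    lift : ∀ {u v} → Walk G u v → WalkIn full u v
    lift here          = here
    lift (step u~v ws) = step u~v refl (lift ws)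

  first-step : ∀ {S a b} → ¬ b ≡ a → WalkIn S a b → Σ (Fin n) λ c → S c ≡ true × a ~ c
  first-step b≢a here              = ⊥-elim (b≢a refl)
  first-step b≢a (step a~c Sc _)   = _ , Sc , a~c

  walk-closed : ∀ {S} {P : Fin n → Set} → (∀ {x y} → P x → S y ≡ true → x ~ y → P y) →
    ∀ {u v} → P u → WalkIn S u v → P v
  walk-closed closed Pu here               = Pu
  walk-closed closed Pu (step u~y Sy rest) = walk-closed closed (closed Pu Sy u~y) rest

  walk-from-centre : ∀ {S c} → (∀ {y} → S y ≡ true → c ~ y → Pendant S y c) →
    ∀ {v} → WalkIn S c v → v ≡ c ⊎ v ~ c
  walk-from-centre spokes here                  = inj₁ refl
  walk-from-centre spokes (step c~y Sy here)    = inj₂ (~-sym c~y)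
  walk-from-centre spokes (step c~y Sy (step y~z Sz rest)) with spokes Sy c~y Sz y~z
  ... | refl = walk-from-centre spokes rest

  PendantSet : VertexSet n → VertexSet n → Set
  PendantSet S R = ∀ {r} → S r ≡ true → R r ≡ true → Σ (Fin n) λ w → Pendant S r w

  -- A walk entering a pendant vertex must leave it the way it came, so that detour can be cut out.
  prune-walk : ∀ {S R} → PendantSet S R → ∀ {u v} → S u ≡ true → R u ≡ false → R v ≡ false →
    WalkIn S u v → WalkIn (S ─ R) u v
  prune-walk pend Su Ru Rv here = here
  prune-walk {S} {R} pend {u} Su Ru Rv (step {v = y} u~y Sy rest) with R y in Ry
  ... | false = step u~y (─-∈ {S = S} {R = R} Sy Ry) (prune-walk pend Sy Ry Rv rest)
  ... | true with rest
  ...   | here with () ← trans (sym Rv) Ry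
  ...   | step y~z Sz rest′ with pend Sy Ry
  ...     | w , only with trans (only Sz y~z) (sym (only Su (~-sym u~y)))
  ...       | refl = prune-walk pend Su Ru Rv rest′

  prune-connected : ∀ {S R} → ConnectedIn S → PendantSet S R → ConnectedIn (S ─ R)
  prune-connected {S} {R} conn pend {u} {v} Su′ Sv′ =
    prune-walk pend (∧-elimˡ Su′) (not-true (∧-elimʳ {S u} Su′)) (not-true (∧-elimʳ {S v} Sv′))
      (conn (∧-elimˡ Su′) (∧-elimˡ Sv′))

  remove-pendant-connected : ∀ {S x w} → ConnectedIn S → Pendant S x w → ConnectedIn (S ∖ x)
  remove-pendant-connected {S} {x} {w} conn only =
    prune-connected conn λ {r} _ r=x → w , subst (λ r → Pendant S r w) (sym (==⇒≡ r=x)) only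

  ∃neighbour? : ∀ (S : VertexSet n) v {P : Fin n → Set} → (∀ y → Dec (P y)) →
    Dec (Σ (Fin n) λ y → S y ≡ true × v ~ y × P y)
  ∃neighbour? S v P? = any? λ y → (S y Bool.≟ true) ×-dec (adj G v y Bool.≟ true) ×-dec P? y

  pendant? : ∀ (S : VertexSet n) v a →
    (Σ (Fin n) λ y → S y ≡ true × v ~ y × ¬ y ≡ a) ⊎ Pendant S v a
  pendant? S v a with ∃neighbour? S v (λ y → ¬? (y ≟ a))
  ... | yes found = inj₁ found
  ... | no  none  = inj₂ λ {z} Sz v~z → decidable-stable (z ≟ a) λ z≢a → none (z , Sz , v~z , z≢a)

  neighbours⊆₂? : ∀ (S : VertexSet n) v a b →
    (Σ (Fin n) λ y → S y ≡ true × v ~ y × ¬ y ≡ a × ¬ y ≡ b) ⊎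
    (∀ {y} → S y ≡ true → v ~ y → y ≡ a ⊎ y ≡ b)
  neighbours⊆₂? S v a b with ∃neighbour? S v (λ y → ¬? (y ≟ a) ×-dec ¬? (y ≟ b))
  ... | yes (y , Sy , v~y , y≢a , y≢b) = inj₁ (y , Sy , v~y , y≢a , y≢b)
  ... | no  none = inj₂ λ Sy v~y → either (λ y≢a y≢b → none (_ , Sy , v~y , y≢a , y≢b))
    where
    either : ∀ {y} → (¬ y ≡ a → ¬ y ≡ b → ⊥) → y ≡ a ⊎ y ≡ b
    either {y} neither with y ≟ a | y ≟ b
    ... | yes y≡a | _       = inj₁ y≡a
    ... | no  _   | yes y≡b = inj₂ y≡b
    ... | no  y≢a | no  y≢b = ⊥-elim (neither y≢a y≢b)

-- Paths and cycles

memberᵇ : ∀ {n} → List (Fin n) → VertexSet n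
memberᵇ []       _ = false
memberᵇ (x ∷ xs)   = insert x (memberᵇ xs)

memberᵇ-∉ : ∀ {n} {x : Fin n} xs → All (λ y → ¬ x ≡ y) xs → memberᵇ xs x ≡ false
memberᵇ-∉         []       []            = refl
memberᵇ-∉ {x = x} (y ∷ ys) (x≢y ∷ x∉ys) rewrite memberᵇ-∉ ys x∉ys = ≢⇒==-false x≢y

count-memberᵇ : ∀ {n} (xs : List (Fin n)) → Unique xs → count (memberᵇ xs) ≡ length xs
count-memberᵇ {n} []       []           = count-none {n} λ _ → refl
count-memberᵇ     (x ∷ xs) (x∉xs ∷ uxs) =
  trans (count-insert (memberᵇ xs) (memberᵇ-∉ xs x∉xs)) (cong suc (count-memberᵇ xs uxs))

Unique⇒length≤n : ∀ {n} (xs : List (Fin n)) → Unique xs → length xs ≤ n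
Unique⇒length≤n xs u = subst (_≤ _) (count-memberᵇ xs u) (count≤n (memberᵇ xs))

unique-++⁻ˡ : ∀ {n} (xs : List (Fin n)) {ys} → Unique (xs ++ ys) → Unique xs
unique-++⁻ˡ []       _          = []
unique-++⁻ˡ (x ∷ xs) (x∉ ∷ uxs) = ++⁻ˡ xs x∉ ∷ unique-++⁻ˡ xs uxs

module _ {n : ℕ} (G : Graph n) where

  linked-close : ∀ {x} ps {b qs c} → Linked (Adj G) (x ∷ ps ++ b ∷ qs) → Adj G b c →
    Linked (Adj G) (x ∷ ps ++ b ∷ c ∷ [])
  linked-close []       (x~b ∷ _) b~c = x~b ∷ b~c ∷ [-]
  linked-close (p ∷ ps) (x~p ∷ l) b~c = x~p ∷ linked-close ps l b~c

  chord⇒cycle : ∀ {a y ys b} → Unique (a ∷ y ∷ ys) → Linked (Adj G) (a ∷ y ∷ ys) →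
    b List.∈ ys → Adj G b a → HasCycle G
  chord⇒cycle {a} {y} {b = b} uniq linked b∈ys b~a with ∈-∃++ b∈ys
  ... | ps , qs , refl =
    a , y ∷ ps ++ b ∷ [] , s≤s (nonempty ps) ,
    unique-++⁻ˡ (a ∷ y ∷ ps ++ b ∷ [])
      (subst Unique (cong (λ zs → a ∷ y ∷ zs) (sym (++-assoc ps (b ∷ []) qs))) uniq) ,
    subst (λ zs → Linked (Adj G) (a ∷ y ∷ zs)) (sym (++-assoc ps (b ∷ []) (a ∷ [])))
      (linked-close (y ∷ ps) linked b~a)
    where
    nonempty : ∀ ps → 1 ≤ length (ps ++ b ∷ [])
    nonempty []      = s≤s z≤n
    nonempty (_ ∷ _) = s≤s z≤n

module LongestPaths {n : ℕ} (G : Graph n) (acyclic : Acyclic G) (S : VertexSet n) where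
  open Neighbourhood G

  PathIn : List (Fin n) → Set
  PathIn ps = Unique ps × Linked _~_ ps × All (λ x → S x ≡ true) ps

  off-path : ∀ {a b rest y} → Unique (a ∷ b ∷ rest) → Linked _~_ (a ∷ b ∷ rest) → a ~ y → ¬ y ≡ b →
    All (λ x → ¬ y ≡ x) (a ∷ b ∷ rest)
  off-path {rest = rest} uniq linked a~y y≢b =
    (~⇒≢ a~y ∘ sym) ∷ y≢b ∷
    ¬Any⇒All¬ rest λ y∈rest → acyclic (chord⇒cycle G uniq linked y∈rest (~-sym a~y))

  beyond : ∀ {x1 x2 rest y} → PathIn (x1 ∷ x2 ∷ rest) → x1 ~ y → ¬ y ≡ x2 → ¬ y List.∈ x2 ∷ rest
  beyond (uniq , linked , _) x1~y y≢x2 with off-path uniq linked x1~y y≢x2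
  ... | _ ∷ y∉ = All¬⇒¬Any y∉

  grow : ∀ {a b rest y} → PathIn (a ∷ b ∷ rest) → S y ≡ true → a ~ y → ¬ y ≡ b →
    PathIn (y ∷ a ∷ b ∷ rest)
  grow (uniq , linked , inS) Sy a~y y≢b =
    off-path uniq linked a~y y≢b ∷ uniq , ~-sym a~y ∷ linked , Sy ∷ inS

  record UnextendableEnd : Set where
    constructor end
    field
      x0 x1      : Fin n
      rest       : List (Fin n)
      path       : PathIn (x0 ∷ x1 ∷ rest)
      x0-pendant : Pendant S x0 x1
      twigs      : ∀ {y} → S y ≡ true → x1 ~ y → ¬ y ≡ x0 → ¬ y List.∈ rest → Pendant S y x1

  -- Every step lengthens a path of distinct vertices, so n steps suffice.
  extend : ∀ fuel {x0 x1 rest} → PathIn (x0 ∷ x1 ∷ rest) → suc n ≤ length (x0 ∷ x1 ∷ rest) + fuel →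
    UnextendableEnd
  extend zero p@(uniq , _) bound =
    ⊥-elim (<⇒≱ (subst (suc n ≤_) (+-identityʳ _) bound) (Unique⇒length≤n _ uniq))
  extend (suc fuel) {x0} {x1} {rest} p@(_ ∷ uniq , _ ∷ linked , _ ∷ inS) bound with pendant? S x0 x1
  ... | inj₁ (y , Sy , x0~y , y≢x1) = extend fuel (grow p Sy x0~y y≢x1) bound′
    where bound′ = subst (suc n ≤_) (+-suc (length (x0 ∷ x1 ∷ rest)) fuel) bound
  ... | inj₂ x0-pendant
    with ∃neighbour? S x1 (λ y → ¬? (y ≟ x0) ×-dec ¬? (Any.any? (y ≟_) rest) ×-dec
                                  ∃neighbour? S y (λ z → ¬? (z ≟ x1)))
  ...   | yes (y , Sy , x1~y , _ , y∉rest , z , Sz , y~z , z≢x1) =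
    extend fuel (grow (y-path , ~-sym x1~y ∷ linked , Sy ∷ inS) Sz y~z z≢x1) bound′
    where
    bound′ = subst (suc n ≤_) (+-suc (length (x0 ∷ x1 ∷ rest)) fuel) bound
    y-path = (~⇒≢ (~-sym x1~y) ∷ ¬Any⇒All¬ rest y∉rest) ∷ uniq
  ...   | no none = end x0 x1 rest p x0-pendant λ Sy x1~y y≢x0 y∉rest {z} Sz y~z →
    decidable-stable (z ≟ x1) λ z≢x1 → none (_ , Sy , x1~y , y≢x0 , y∉rest , z , Sz , y~z , z≢x1)

  record LongPathEnd : Set where
    field
      x0 x1 x2 x3 : Fin n
      S-x0  : S x0 ≡ true
      S-x1  : S x1 ≡ true
      S-x2  : S x2 ≡ true
      S-x3  : S x3 ≡ true
      x1~x0 : x1 ~ x0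
      x1~x2 : x1 ~ x2
      x2~x3 : x2 ~ x3
      x3≢x1 : ¬ x3 ≡ x1
      x0≢x2 : ¬ x0 ≡ x2
      twigs : ∀ {y} → S y ≡ true → x1 ~ y → ¬ y ≡ x2 → Pendant S y x1

  IsStar : Set
  IsStar = Σ (Fin n) λ c → S c ≡ true × ∀ {v} → S v ≡ true → ¬ v ≡ c → v ~ c

  star : ConnectedIn S → ∀ {c} → S c ≡ true → (∀ {y} → S y ≡ true → c ~ y → Pendant S y c) →
    IsStar
  star conn {c} Sc spokes =
    c , Sc , λ Sv v≢c → [ ⊥-elim ∘ v≢c , id ] (walk-from-centre spokes (conn Sc Sv))

  classify : ConnectedIn S → UnextendableEnd → IsStar ⊎ LongPathEnd
  classify conn (end x0 x1 [] (_ , x0~x1 ∷ _ , S-x0 ∷ S-x1 ∷ _) x0-pendant twigs) =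
    inj₁ (star conn S-x1 spokes)
    where
    spokes : ∀ {y} → S y ≡ true → x1 ~ y → Pendant S y x1
    spokes {y} Sy x1~y with y ≟ x0
    ... | yes refl   = x0-pendant
    ... | no  y≢x0   = twigs Sy x1~y y≢x0 λ ()
  classify conn (end x0 x1 (x2 ∷ rest) ((_ ∷ x0≢x2 ∷ _) ∷ uniq , x0~x1 ∷ linked , S-x0 ∷ inS)
                    x0-pendant twigs) = from-x2 (pendant? S x2 x1)
    where
    S-x1 = All.head inS
    spokes-but-x2 : ∀ {y} → S y ≡ true → x1 ~ y → ¬ y ≡ x2 → Pendant S y x1
    spokes-but-x2 {y} Sy x1~y y≢x2 with y ≟ x0
    ... | yes refl = x0-pendant
    ... | no  y≢x0 = twigs Sy x1~y y≢x0 (beyond (uniq , linked , inS) x1~y y≢x2)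
    spokes : Pendant S x2 x1 → ∀ {y} → S y ≡ true → x1 ~ y → Pendant S y x1
    spokes x2-pendant {y} Sy x1~y with y ≟ x2
    ... | yes refl = x2-pendant
    ... | no  y≢x2 = spokes-but-x2 Sy x1~y y≢x2
    from-x2 : (Σ (Fin n) λ y → S y ≡ true × x2 ~ y × ¬ y ≡ x1) ⊎ Pendant S x2 x1 →
      IsStar ⊎ LongPathEnd
    from-x2 (inj₁ (x3 , S-x3 , x2~x3 , x3≢x1)) = inj₂ record
      { x0 = x0 ; x1 = x1 ; x2 = x2 ; x3 = x3
      ; S-x0 = S-x0 ; S-x1 = S-x1 ; S-x2 = All.head (All.tail inS) ; S-x3 = S-x3
      ; x1~x0 = ~-sym x0~x1 ; x1~x2 = Linked.head linked ; x2~x3 = x2~x3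
      ; x3≢x1 = x3≢x1 ; x0≢x2 = x0≢x2 ; twigs = spokes-but-x2 }
    from-x2 (inj₂ x2-pendant) = inj₁ (star conn S-x1 (spokes x2-pendant))

  star-or-end : ConnectedIn S → 2 ≤ count S → IsStar ⊎ LongPathEnd
  star-or-end conn 2≤ with 1≤count⇒∈ S (≤-trans (s≤s z≤n) 2≤)
  ... | a , Sa with another-∈ S Sa 2≤
  ... | b , Sb , b≢a with first-step b≢a (conn Sa Sb)
  ... | c , Sc , a~c =
    classify conn (extend n ((~⇒≢ a~c ∷ []) ∷ [] ∷ [] , a~c ∷ [-] , Sa ∷ Sc ∷ []) (s≤s (n≤1+n n)))

-- Perfect dominating sets

module PerfectSets {n : ℕ} (G : Graph n) where
  open Neighbourhood G

  PerfectIn : VertexSet n → VertexSet n → Set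
  PerfectIn S D = D ⊆ S × (∀ {v} → S v ≡ true → D v ≡ false → degree D v ≡ 1)

  SmallPerfect : VertexSet n → Set
  SmallPerfect S = Σ (VertexSet n) λ D → PerfectIn S D × 2 * count D < count S

  HalfPerfect : VertexSet n → Set
  HalfPerfect S = Σ (VertexSet n) λ D → PerfectIn S D × 2 * count D ≤ count S

  leaves : VertexSet n → VertexSet n
  leaves S v = S v ∧ isLeaf S v

  CoronaLike : VertexSet n → Set
  CoronaLike S = ∀ {v} → S v ≡ true → isLeaf S v ≡ true ⊎ degree (leaves S) v ≡ 1

  degree-insert : ∀ {D x} v → D x ≡ false → degree (insert x D) v ≡ toℕ (adj G v x) + degree D v
  degree-insert {D} {x} v Dx with adj G v x in v~x
  ... | true  = trans (count-cong pointwise) (count-insert (nbr D v) (cong (_∧ adj G v x) Dx))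
    where
    pointwise : ∀ w → ((D w ∨ (w == x)) ∧ adj G v w) ≡ ((D w ∧ adj G v w) ∨ (w == x))
    pointwise w with w ≟ x
    ... | yes refl rewrite Dx | v~x = refl
    ... | no  _    rewrite ∨-identityʳ (D w) = sym (∨-identityʳ _)
  ... | false = count-cong pointwise
    where
    pointwise : ∀ w → ((D w ∨ (w == x)) ∧ adj G v w) ≡ (D w ∧ adj G v w)
    pointwise w with w ≟ x
    ... | yes refl rewrite v~x = trans (∧-zeroʳ _) (sym (∧-zeroʳ _))
    ... | no  _    = cong (_∧ adj G v w) (∨-identityʳ (D w))

  perfect-lift : ∀ {S T D} → T ⊆ S → PerfectIn T D →
    (∀ {v} → S v ≡ true → T v ≡ false → D v ≡ false → degree D v ≡ 1) → PerfectIn S D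
  perfect-lift {S} {T} {D} T⊆S (D⊆T , perfect) outside = T⊆S ∘ D⊆T , lifted
    where
    lifted : ∀ {v} → S v ≡ true → D v ≡ false → degree D v ≡ 1
    lifted {v} Sv Dv with T v in Tv
    ... | true  = perfect Tv Dv
    ... | false = outside Sv Tv Dv

  perfect-insert : ∀ {S T D x} → T ⊆ S → PerfectIn T D → S x ≡ true → D x ≡ false →
    (∀ {v} → T v ≡ true → D v ≡ false → ¬ v ~ x) →
    (∀ {v} → S v ≡ true → T v ≡ false → ¬ v ≡ x → degree (insert x D) v ≡ 1) →
    PerfectIn S (insert x D)
  perfect-insert {S} {T} {D} {x} T⊆S (D⊆T , perfect) Sx Dx apart outside =
    insert-⊆ {D = D} (T⊆S ∘ D⊆T) Sx , extended
    where
    extended : ∀ {v} → S v ≡ true → insert x D v ≡ false → degree (insert x D) v ≡ 1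
    extended {v} Sv Iv with T v in Tv
    ... | false = outside Sv Tv (insert-∉⇒≢ D Iv)
    ... | true  = trans (degree-insert v Dx)
                        (cong₂ _+_ (cong toℕ (¬true⇒false (apart Tv Dv))) (perfect Tv Dv))
      where Dv = insert-∉⁻ D Iv

  centre-perfect : ∀ {S c} → S c ≡ true → (∀ {v} → S v ≡ true → ¬ v ≡ c → v ~ c) →
    PerfectIn S (_== c)
  centre-perfect {S} {c} Sc spokes =
    (λ y=c → subst (λ y → S y ≡ true) (sym (==⇒≡ y=c)) Sc) ,
    λ Sv v≠c → pendant⇒degree≡1 (==-refl c) (spokes Sv (==-false⇒≢ v≠c)) (λ z=c _ → ==⇒≡ z=c)

  leaf-pair⇒count≤2 : ∀ {S v} → ConnectedIn S → S v ≡ true → isLeaf S v ≡ true →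
    isLeaf S (partner S v) ≡ true → count S ≤ 2
  leaf-pair⇒count≤2 {S} {v} conn Sv v-leaf w-leaf =
    ≤-trans (count-mono S⊆pair) (≤-reflexive count-pair)
    where
    w = partner S v
    v~w = partner-~ v-leaf
    v-pendant = partner-pendant v-leaf
    w-pendant = partner-pendant w-leaf
    count-pair : count (insert w (_== v)) ≡ 2
    count-pair = trans (count-insert (_== v) (≢⇒==-false (~⇒≢ v~w ∘ sym)))
                       (cong suc (count-singleton v))
    closed : ∀ {x y} → x ≡ v ⊎ x ≡ w → S y ≡ true → x ~ y → y ≡ v ⊎ y ≡ w
    closed (inj₁ refl) Sy v~y = inj₂ (v-pendant Sy v~y)
    closed (inj₂ refl) Sy w~y = inj₁ (trans (w-pendant Sy w~y) (sym (w-pendant Sv (~-sym v~w))))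
    S⊆pair : ∀ x → S x ≡ true → insert w (_== v) x ≡ true
    S⊆pair x Sx with walk-closed closed (inj₁ refl) (conn Sv Sx)
    ... | inj₁ refl = insert-⊇ {x = w} {_== v} {v} (==-refl v)
    ... | inj₂ refl = insert-∈ w (_== v)

  leaves-perfect : ∀ {S} → ConnectedIn S → 3 ≤ count S → CoronaLike S →
    PerfectIn S (leaves S) × 2 * count (leaves S) ≤ count S
  leaves-perfect {S} conn 3≤ corona = (∧-elimˡ , perfect) , size
    where
    perfect : ∀ {v} → S v ≡ true → leaves S v ≡ false → degree (leaves S) v ≡ 1
    perfect {v} Sv Lv with corona Sv
    ... | inj₁ leaf with () ← trans (sym (∧-falseʳ Lv Sv)) leaf
    ... | inj₂ one = one
    partner-inner : ∀ {x} → leaves S x ≡ true → (S ─ isLeaf S) (partner S x) ≡ true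
    partner-inner {x} Lx with isLeaf S (partner S x) in w-leaf
    ... | false = ∧-intro (partner-∈ (∧-elimʳ {S x} Lx)) refl
    ... | true  = ⊥-elim (<⇒≱ 3≤ (leaf-pair⇒count≤2 conn (∧-elimˡ Lx) (∧-elimʳ {S x} Lx) w-leaf))
    partner-injective : ∀ {x y} → leaves S x ≡ true → leaves S y ≡ true →
      partner S x ≡ partner S y → x ≡ y
    partner-injective {x} {y} Lx Ly eq with corona (─-⊆ {S = S} {R = isLeaf S} (partner-inner Lx))
    ... | inj₁ leaf with () ← trans (sym (not-true (∧-elimʳ {S (partner S x)} (partner-inner Lx)))) leaf
    ... | inj₂ one = count≡1⇒unique (nbr (leaves S) (partner S x)) one
                       (∧-intro Lx (~-sym (partner-~ (∧-elimʳ {S x} Lx))))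
                       (∧-intro Ly (subst (_~ y) (sym eq) (~-sym (partner-~ (∧-elimʳ {S y} Ly)))))
    size : 2 * count (leaves S) ≤ count S
    size = begin
      2 * count (leaves S)                     ≡⟨ cong (count (leaves S) +_) (+-identityʳ _) ⟩
      count (leaves S) + count (leaves S)      ≤⟨ +-monoʳ-≤ (count (leaves S))
                                                   (count-mono-injective (leaves S) (S ─ isLeaf S) (partner S)
                                                      partner-inner partner-injective) ⟩
      count (leaves S) + count (S ─ isLeaf S)  ≡⟨ count-split S (isLeaf S) ⟨
      count S                                  ∎
      where open ≤-Reasoning

  module _ {S} (conn : ConnectedIn S) (two : count S ≡ 2) where

    pair-adjacent : ∀ {a v} → S a ≡ true → S v ≡ true → ¬ v ≡ a → v ~ a
    pair-adjacent Sa Sv v≢a with first-step v≢a (conn Sa Sv)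
    ... | c , Sc , a~c =
      subst (_~ _) (count≡2⇒unique-other S two Sa Sc Sv (~⇒≢ a~c ∘ sym) v≢a) (~-sym a~c)

    pair-corona-like : CoronaLike S
    pair-corona-like {v} Sv with another-∈ S Sv (≤-reflexive (sym two))
    ... | b , Sb , b≢v = inj₁ (pendant⇒isLeaf Sb (pair-adjacent Sb Sv (b≢v ∘ sym))
                                 λ Sz v~z → count≡2⇒unique-other S two Sv Sz Sb (~⇒≢ v~z ∘ sym) b≢v)

    pair-half-perfect : HalfPerfect S
    pair-half-perfect with 1≤count⇒∈ S (subst (1 ≤_) (sym two) (s≤s z≤n))
    ... | a , Sa = (_== a) , centre-perfect Sa (pair-adjacent Sa) ,
                   subst (λ k → 2 * k ≤ count S) (sym (count-singleton a)) (≤-reflexive (sym two))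

module Dichotomy {n : ℕ} (G : Graph n) (acyclic : Acyclic G) where
  open Neighbourhood G
  open PerfectSets G
  open LongestPaths G acyclic using (LongPathEnd; star-or-end)

  CoronaOrSmall : VertexSet n → Set
  CoronaOrSmall S = CoronaLike S ⊎ SmallPerfect S

  Smaller : VertexSet n → Set
  Smaller S = ∀ {T} → count T < count S → ConnectedIn T → 2 ≤ count T → CoronaOrSmall T

  half-perfect : ∀ {S} → ConnectedIn S → 2 ≤ count S → CoronaOrSmall S → HalfPerfect S
  half-perfect conn 2≤ (inj₂ (D , perfect , small)) = D , perfect , <⇒≤ small
  half-perfect conn 2≤ (inj₁ corona) with m≤n⇒m<n∨m≡n 2≤
  ... | inj₁ 3≤ = _ , leaves-perfect conn 3≤ corona
  ... | inj₂ 2≡ = pair-half-perfect conn (sym 2≡)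

  insert-small-perfect : ∀ {S T D x} → T ⊆ S → PerfectIn T D → S x ≡ true → D x ≡ false →
    (∀ {v} → T v ≡ true → D v ≡ false → ¬ v ~ x) →
    (∀ {v} → S v ≡ true → T v ≡ false → ¬ v ≡ x → degree (insert x D) v ≡ 1) →
    3 + 2 * count D ≤ count S → SmallPerfect S
  insert-small-perfect {S} {D = D} {x} T⊆S perfect Sx Dx apart outside bound =
    insert x D , perfect-insert T⊆S perfect Sx Dx apart outside ,
    subst (λ c → 2 * c < count S) (sym (count-insert D Dx))
          (subst (_< count S) (sym (*-suc 2 (count D))) bound)

  module _ {S : VertexSet n} (conn : ConnectedIn S) (ih : Smaller S) (p : LongPathEnd S) where
    open LongestPaths.LongPathEnd p

    x0-pendant : Pendant S x0 x1
    x0-pendant = twigs S-x0 x1~x0 x0≢x2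

    x0~x1 : x0 ~ x1
    x0~x1 = ~-sym x1~x0

    x1≢x2 : ¬ x1 ≡ x2
    x1≢x2 = ~⇒≢ x1~x2

    x2≢x3 : ¬ x2 ≡ x3
    x2≢x3 = ~⇒≢ x2~x3

    ¬~x0 : ∀ {v} → S v ≡ true → ¬ v ≡ x1 → ¬ v ~ x0
    ¬~x0 Sv v≢x1 v~x0 = v≢x1 (x0-pendant Sv (~-sym v~x0))

    x3≢x0 : ¬ x3 ≡ x0
    x3≢x0 x3≡x0 = ¬~x0 S-x2 (x1≢x2 ∘ sym) (subst (x2 ~_) x3≡x0 x2~x3)

    x0-leaf : isLeaf S x0 ≡ true
    x0-leaf = pendant⇒isLeaf S-x1 x0~x1 x0-pendant

    x1∉leaves : leaves S x1 ≡ false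
    x1∉leaves = trans (cong (S x1 ∧_) (2≤degree⇒¬isLeaf {S}
                        (two-∈⇒2≤count (nbr S x1) x0≢x2 (∧-intro S-x0 x1~x0) (∧-intro S-x2 x1~x2))))
                      (∧-zeroʳ _)

    x2-inner : isLeaf S x2 ≡ false
    x2-inner = 2≤degree⇒¬isLeaf {S} (two-∈⇒2≤count (nbr S x2) (x3≢x1 ∘ sym)
                                        (∧-intro S-x1 (~-sym x1~x2)) (∧-intro S-x3 x2~x3))

    x2∉leaves : leaves S x2 ≡ false
    x2∉leaves = trans (cong (S x2 ∧_) x2-inner) (∧-zeroʳ _)

    module SecondLeafAtX1 {x0′} (S-x0′ : S x0′ ≡ true) (x1~x0′ : x1 ~ x0′)
                          (x0′≢x2 : ¬ x0′ ≡ x2) (x0′≢x0 : ¬ x0′ ≡ x0) where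

      R : VertexSet n
      R = nbr S x1 ∖ x2

      T : VertexSet n
      T = S ─ R

      R-∈ : ∀ {y} → S y ≡ true → x1 ~ y → ¬ y ≡ x2 → R y ≡ true
      R-∈ Sy x1~y y≢x2 = ∖-∈ {S = nbr S x1} (∧-intro Sy x1~y) y≢x2

      R-pendant : ∀ {r} → R r ≡ true → Pendant S r x1 × r ~ x1
      R-pendant {r} Rr = twigs (∧-elimˡ nbr-r) x1~r (∖-≢ {S = nbr S x1} Rr) , ~-sym x1~r
        where
        nbr-r = ─-⊆ {S = nbr S x1} {R = _== x2} Rr
        x1~r  = ∧-elimʳ {S r} nbr-r

      T⊆S : T ⊆ S
      T⊆S = ─-⊆ {S = S} {R = R}

      T-∈ : ∀ {y} → S y ≡ true → R y ≡ false → T y ≡ true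
      T-∈ = ─-∈ {S = S} {R = R}

      T-x1 : T x1 ≡ true
      T-x1 = T-∈ S-x1 (¬true⇒false λ R-x1 → ~⇒≢ (proj₂ (R-pendant R-x1)) refl)

      T-x2 : T x2 ≡ true
      T-x2 = T-∈ S-x2 (¬true⇒false λ R-x2 → ∖-≢ {S = nbr S x1} R-x2 refl)

      T-x3 : T x3 ≡ true
      T-x3 = T-∈ S-x3 (¬true⇒false λ R-x3 →
               x1≢x2 (sym (proj₁ (R-pendant R-x3) S-x2 (~-sym x2~x3))))

      conn-T : ConnectedIn T
      conn-T = prune-connected conn λ _ Rr → x1 , proj₁ (R-pendant Rr)

      3≤T : 3 ≤ count T
      3≤T = three-∈⇒3≤count T x1≢x2 (x3≢x1 ∘ sym) x2≢x3 T-x1 T-x2 T-x3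

      2+T≤S : 2 + count T ≤ count S
      2+T≤S = begin
        2 + count T                       ≤⟨ +-monoˡ-≤ (count T)
                                               (two-∈⇒2≤count (λ y → S y ∧ R y) x0′≢x0
                                                 (∧-intro S-x0′ (R-∈ S-x0′ x1~x0′ x0′≢x2))
                                                 (∧-intro S-x0 (R-∈ S-x0 x1~x0 x0≢x2))) ⟩
        count (λ y → S y ∧ R y) + count T ≡⟨ count-split S R ⟨
        count S                           ∎
        where open ≤-Reasoning

      T<S : count T < count S
      T<S = ≤-trans (n≤1+n _) 2+T≤S

      x1-pendant-in-T : Pendant T x1 x2
      x1-pendant-in-T {y} Ty x1~y = decidable-stable (y ≟ x2) λ y≢x2 →
        true≢false (trans (sym (R-∈ (T⊆S Ty) x1~y y≢x2)) (not-true (∧-elimʳ {S y} Ty)))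

      outside : ∀ {D} → D ⊆ S → D x1 ≡ true →
        ∀ {v} → S v ≡ true → T v ≡ false → degree D v ≡ 1
      outside D⊆S Dx1 Sv Tv with R-pendant (─-∉ {S = S} {R = R} Sv Tv)
      ... | pendant , v~x1 = pendant⇒degree≡1 Dx1 v~x1 (pendant ∘ D⊆S)

      via-leaves : CoronaLike T → SmallPerfect S
      via-leaves corona with leaves-perfect conn-T 3≤T corona
      ... | perfect , half =
        leaves T ,
        perfect-lift T⊆S perfect (λ Sv Tv _ → outside (T⊆S ∘ proj₁ perfect) x1-leaf Sv Tv) ,
        ≤-<-trans half T<S
        where
        x1-leaf : leaves T x1 ≡ true
        x1-leaf = ∧-intro T-x1 (pendant⇒isLeaf T-x2 x1~x2 x1-pendant-in-T)

      module _ {D} (perfect : PerfectIn T D) (small : 2 * count D < count T) where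

        D⊆S : D ⊆ S
        D⊆S = T⊆S ∘ proj₁ perfect

        containing-x1 : D x1 ≡ true → SmallPerfect S
        containing-x1 Dx1 =
          D , perfect-lift T⊆S perfect (λ Sv Tv _ → outside D⊆S Dx1 Sv Tv) , <-trans small T<S

        -- x1 has a single neighbour x2 in T, so it can only be dominated by x2.
        avoiding-x1 : D x1 ≡ false → SmallPerfect S
        avoiding-x1 Dx1 =
          insert-small-perfect T⊆S perfect S-x1 Dx1 apart
            (λ Sv Tv _ → outside (insert-⊆ {D = D} D⊆S S-x1) (insert-∈ x1 D) Sv Tv)
            (≤-trans (s≤s (s≤s small)) 2+T≤S)
          where
          D-x2 : D x2 ≡ true
          D-x2 with 1≤count⇒∈ (nbr D x1) (≤-reflexive (sym (proj₂ perfect T-x1 Dx1)))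
          ... | y , h = subst (λ y → D y ≡ true)
                              (x1-pendant-in-T (proj₁ perfect (∧-elimˡ h)) (∧-elimʳ {D y} h)) (∧-elimˡ h)
          apart : ∀ {v} → T v ≡ true → D v ≡ false → ¬ v ~ x1
          apart Tv Dv v~x1 with x1-pendant-in-T Tv (~-sym v~x1)
          ... | refl = true≢false (trans (sym D-x2) Dv)

      small : SmallPerfect S
      small with ih T<S conn-T (≤-trans (n≤1+n 2) 3≤T)
      ... | inj₁ corona = via-leaves corona
      ... | inj₂ (D , perfect , small) with D x1 in Dx1
      ...   | true  = containing-x1 perfect small Dx1
      ...   | false = avoiding-x1 perfect small Dx1

    module WithoutX0X1 (x1-nbrs : ∀ {y} → S y ≡ true → x1 ~ y → y ≡ x2 ⊎ y ≡ x0) where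

      T : VertexSet n
      T = (S ∖ x0) ∖ x1

      T⊆S : T ⊆ S
      T⊆S = ─-⊆ {S = S} {R = _== x0} ∘ ─-⊆ {S = S ∖ x0} {R = _== x1}

      T-∈ : ∀ {v} → S v ≡ true → ¬ v ≡ x0 → ¬ v ≡ x1 → T v ≡ true
      T-∈ Sv v≢x0 v≢x1 = ∖-∈ {S = S ∖ x0} (∖-∈ {S = S} Sv v≢x0) v≢x1

      T-≢x0 : ∀ {v} → T v ≡ true → ¬ v ≡ x0
      T-≢x0 = ∖-≢ {S = S} ∘ ─-⊆ {S = S ∖ x0} {R = _== x1}

      T-≢x1 : ∀ {v} → T v ≡ true → ¬ v ≡ x1
      T-≢x1 = ∖-≢ {S = S ∖ x0}

      T-≡ : ∀ {v} → ¬ v ≡ x0 → ¬ v ≡ x1 → T v ≡ S v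
      T-≡ v≢x0 v≢x1 = trans (∖-≡ (S ∖ x0) v≢x1) (∖-≡ S v≢x0)

      T-∉ : ∀ {v} → S v ≡ true → T v ≡ false → v ≡ x0 ⊎ v ≡ x1
      T-∉ {v} Sv Tv = decide (v ≟ x0) (v ≟ x1)
        where
        decide : Dec (v ≡ x0) → Dec (v ≡ x1) → v ≡ x0 ⊎ v ≡ x1
        decide (yes v≡x0) _          = inj₁ v≡x0
        decide (no  _)    (yes v≡x1) = inj₂ v≡x1
        decide (no  v≢x0) (no  v≢x1) = ⊥-elim (true≢false (trans (sym (T-∈ Sv v≢x0 v≢x1)) Tv))

      T-x0 : T x0 ≡ false
      T-x0 = cong (_∧ not (x0 == x1)) (∖-∉ S x0)

      T-x1 : T x1 ≡ false
      T-x1 = ∖-∉ (S ∖ x0) x1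

      T-x3 : T x3 ≡ true
      T-x3 = T-∈ S-x3 x3≢x0 x3≢x1

      conn-T : ConnectedIn T
      conn-T = remove-pendant-connected (remove-pendant-connected conn x0-pendant) x1-pendant
        where
        x1-pendant : Pendant (S ∖ x0) x1 x2
        x1-pendant {y} Sy x1~y =
          [ id , ⊥-elim ∘ ∖-≢ {S = S} Sy ] (x1-nbrs (─-⊆ {S = S} {R = _== x0} Sy) x1~y)

      count-S : count S ≡ 2 + count T
      count-S = trans (count-remove S S-x0)
                      (cong suc (count-remove (S ∖ x0) (∖-∈ {S = S} S-x1 (~⇒≢ x0~x1 ∘ sym))))

      ¬~x1 : ∀ {v} → S v ≡ true → ¬ v ≡ x2 → ¬ v ≡ x0 → ¬ v ~ x1
      ¬~x1 Sv v≢x2 v≢x0 v~x1 = [ v≢x2 , v≢x0 ] (x1-nbrs Sv (~-sym v~x1))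

    module X2OfHighDegree (x1-nbrs : ∀ {y} → S y ≡ true → x1 ~ y → y ≡ x2 ⊎ y ≡ x0)
                 {z} (S-z : S z ≡ true) (x2~z : x2 ~ z) (z≢x1 : ¬ z ≡ x1) (z≢x3 : ¬ z ≡ x3) where
      open WithoutX0X1 x1-nbrs

      T-z : T z ≡ true
      T-z = T-∈ S-z (λ z≡x0 → ¬~x0 S-x2 (x1≢x2 ∘ sym) (subst (x2 ~_) z≡x0 x2~z)) z≢x1

      module _ {D} (perfect : PerfectIn T D) (small : 2 * count D < count T) where

        D⊆S : D ⊆ S
        D⊆S = T⊆S ∘ proj₁ perfect

        bound : 3 + 2 * count D ≤ count S
        bound = ≤-trans (s≤s (s≤s small)) (≤-reflexive (sym count-S))

        via-x1 : D x2 ≡ true → SmallPerfect S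
        via-x1 Dx2 =
          insert-small-perfect T⊆S perfect S-x1 (⊆-∉ {D = D} (proj₁ perfect) T-x1) apart outside bound
          where
          apart : ∀ {v} → T v ≡ true → D v ≡ false → ¬ v ~ x1
          apart Tv Dv = ¬~x1 (T⊆S Tv) (λ { refl → true≢false (trans (sym Dx2) Dv) }) (T-≢x0 Tv)
          outside : ∀ {v} → S v ≡ true → T v ≡ false → ¬ v ≡ x1 → degree (insert x1 D) v ≡ 1
          outside Sv Tv v≢x1 with T-∉ Sv Tv
          ... | inj₁ refl =
            pendant⇒degree≡1 (insert-∈ x1 D) x0~x1 (x0-pendant ∘ insert-⊆ {D = D} D⊆S S-x1)
          ... | inj₂ refl = ⊥-elim (v≢x1 refl)

        via-x0 : D x2 ≡ false → SmallPerfect S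
        via-x0 Dx2 = insert-small-perfect T⊆S perfect S-x0 (⊆-∉ {D = D} (proj₁ perfect) T-x0)
                       (λ Tv _ → ¬~x0 (T⊆S Tv) (T-≢x1 Tv)) outside bound
          where
          outside : ∀ {v} → S v ≡ true → T v ≡ false → ¬ v ≡ x0 → degree (insert x0 D) v ≡ 1
          outside Sv Tv v≢x0 with T-∉ Sv Tv
          ... | inj₁ refl = ⊥-elim (v≢x0 refl)
          ... | inj₂ refl = pendant⇒degree≡1 (insert-∈ x0 D) x1~x0
                              (pendant-by-elimination (insert-⊆ {D = D} D⊆S S-x0) x1-nbrs
                                 (insert-∉ {D = D} Dx2 (x0≢x2 ∘ sym)))

      from-small : SmallPerfect T → SmallPerfect S
      from-small (D , perfect , small) with D x2 in Dx2
      ... | true  = via-x1 perfect small Dx2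
      ... | false = via-x0 perfect small Dx2

      x2-inner-T : isLeaf T x2 ≡ false
      x2-inner-T = 2≤degree⇒¬isLeaf {T} (two-∈⇒2≤count (nbr T x2) (z≢x3 ∘ sym)
                                            (∧-intro T-x3 x2~x3) (∧-intro T-z x2~z))

      same-nbr : ∀ {v} → T v ≡ true → ¬ v ≡ x2 → ∀ y → nbr S v y ≡ nbr T v y
      same-nbr {v} Tv v≢x2 y = ∧-congˡ-true (adj G v y) λ v~y →
        sym (T-≡ (λ { refl → ¬~x0 (T⊆S Tv) (T-≢x1 Tv) v~y })
                 (λ { refl → ¬~x1 (T⊆S Tv) v≢x2 (T-≢x0 Tv) v~y }))

      same-isLeaf : ∀ {v} → T v ≡ true → ¬ v ≡ x2 → isLeaf S v ≡ isLeaf T v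
      same-isLeaf Tv v≢x2 = cong (_≡ᵇ 1) (count-cong (same-nbr Tv v≢x2))

      same-leaves-near : ∀ {v y} → T v ≡ true → v ~ y → leaves S y ≡ leaves T y
      same-leaves-near {v} {y} Tv v~y =
        [ at x1 (trans x1∉leaves (sym (cong (_∧ isLeaf T x1) T-x1))) ,
          (λ y≢x1 → [ at x2 (trans x2∉leaves (sym (trans (cong (T x2 ∧_) x2-inner-T) (∧-zeroʳ _)))) ,
                      elsewhere y≢x1
                    ]′ (toSum (y ≟ x2)))
        ]′ (toSum (y ≟ x1))
        where
        at : ∀ a → leaves S a ≡ leaves T a → y ≡ a → leaves S y ≡ leaves T y
        at a eq refl = eq
        y≢x0 : ¬ y ≡ x0
        y≢x0 y≡x0 = ¬~x0 (T⊆S Tv) (T-≢x1 Tv) (subst (v ~_) y≡x0 v~y)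
        elsewhere : ¬ y ≡ x1 → ¬ y ≡ x2 → leaves S y ≡ leaves T y
        elsewhere y≢x1 y≢x2 =
          trans (∧-congʳ-true (S y) λ Sy → same-isLeaf (T-∈ Sy y≢x0 y≢x1) y≢x2)
                (cong (_∧ isLeaf T y) (sym (T-≡ y≢x0 y≢x1)))

      lift-corona : CoronaLike T → CoronaLike S
      lift-corona corona {v} Sv with v ≟ x0 | v ≟ x1
      ... | yes refl | _        = inj₁ x0-leaf
      ... | no  _    | yes refl = inj₂ (pendant⇒degree≡1 (∧-intro S-x0 x0-leaf) x1~x0
                                         (pendant-by-elimination ∧-elimˡ x1-nbrs x2∉leaves))
      ... | no  v≢x0 | no  v≢x1 with T-∈ Sv v≢x0 v≢x1
      ...   | Tv with corona Tv
      ...     | inj₂ one  =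
        inj₂ (trans (count-cong λ y → ∧-congˡ-true (adj G v y) (same-leaves-near Tv)) one)
      ...     | inj₁ leaf = inj₁ (trans (same-isLeaf Tv v≢x2) leaf)
        where
        v≢x2 : ¬ v ≡ x2
        v≢x2 refl = true≢false (trans (sym leaf) x2-inner-T)

      result : CoronaOrSmall S
      result = Sum.map lift-corona from-small
                 (ih (subst (count T <_) (sym count-S) (n≤1+n _)) conn-T
                     (two-∈⇒2≤count T (z≢x3 ∘ sym) T-x3 T-z))

    module X2OfDegreeTwo (x1-nbrs : ∀ {y} → S y ≡ true → x1 ~ y → y ≡ x2 ⊎ y ≡ x0)
                 (x2-nbrs : ∀ {y} → S y ≡ true → x2 ~ y → y ≡ x1 ⊎ y ≡ x3) where

      OnPath : Fin n → Set
      OnPath y = y ≡ x0 ⊎ y ≡ x1 ⊎ y ≡ x2 ⊎ y ≡ x3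

      path-corona-like : Pendant S x3 x2 → CoronaLike S
      path-corona-like x3-pendant {v} Sv with walk-closed closed (inj₁ refl) (conn S-x0 Sv)
        where
        closed : ∀ {x y} → OnPath x → S y ≡ true → x ~ y → OnPath y
        closed (inj₁ refl)               Sy x~y = inj₂ (inj₁ (x0-pendant Sy x~y))
        closed (inj₂ (inj₁ refl))        Sy x~y = [ inj₂ ∘ inj₂ ∘ inj₁ , inj₁ ] (x1-nbrs Sy x~y)
        closed (inj₂ (inj₂ (inj₁ refl))) Sy x~y = [ inj₂ ∘ inj₁ , inj₂ ∘ inj₂ ∘ inj₂ ] (x2-nbrs Sy x~y)
        closed (inj₂ (inj₂ (inj₂ refl))) Sy x~y = inj₂ (inj₂ (inj₁ (x3-pendant Sy x~y)))
      ... | inj₁ refl               = inj₁ x0-leaf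
      ... | inj₂ (inj₁ refl)        = inj₂ (pendant⇒degree≡1 (∧-intro S-x0 x0-leaf) x1~x0
                                              (pendant-by-elimination ∧-elimˡ x1-nbrs x2∉leaves))
      ... | inj₂ (inj₂ (inj₁ refl)) = inj₂ (pendant⇒degree≡1 (∧-intro S-x3 x3-leaf) x2~x3
                                              (pendant-by-elimination ∧-elimˡ x2-nbrs x1∉leaves))
        where x3-leaf = pendant⇒isLeaf S-x2 (~-sym x2~x3) x3-pendant
      ... | inj₂ (inj₂ (inj₂ refl)) = inj₁ (pendant⇒isLeaf S-x2 (~-sym x2~x3) x3-pendant)

      module _ {z} (S-z : S z ≡ true) (x3~z : x3 ~ z) (z≢x2 : ¬ z ≡ x2) where
        open WithoutX0X1 x1-nbrs

        U : VertexSet n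
        U = T ∖ x2

        U⊆S : U ⊆ S
        U⊆S = T⊆S ∘ ─-⊆ {S = T} {R = _== x2}

        U-∈ : ∀ {v} → S v ≡ true → ¬ v ≡ x0 → ¬ v ≡ x1 → ¬ v ≡ x2 → U v ≡ true
        U-∈ Sv v≢x0 v≢x1 = ∖-∈ {S = T} (T-∈ Sv v≢x0 v≢x1)

        U-≢x0 : ∀ {v} → U v ≡ true → ¬ v ≡ x0
        U-≢x0 = T-≢x0 ∘ ─-⊆ {S = T} {R = _== x2}

        U-≢x1 : ∀ {v} → U v ≡ true → ¬ v ≡ x1
        U-≢x1 = T-≢x1 ∘ ─-⊆ {S = T} {R = _== x2}

        U-≢x2 : ∀ {v} → U v ≡ true → ¬ v ≡ x2
        U-≢x2 = ∖-≢ {S = T}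

        U-∉ : ∀ {v} → S v ≡ true → U v ≡ false → v ≡ x0 ⊎ v ≡ x1 ⊎ v ≡ x2
        U-∉ {v} Sv Uv = decide (v ≟ x0) (v ≟ x1) (v ≟ x2)
          where
          decide : Dec (v ≡ x0) → Dec (v ≡ x1) → Dec (v ≡ x2) → v ≡ x0 ⊎ v ≡ x1 ⊎ v ≡ x2
          decide (yes v≡x0) _          _          = inj₁ v≡x0
          decide (no  _)    (yes v≡x1) _          = inj₂ (inj₁ v≡x1)
          decide (no  _)    (no  _)    (yes v≡x2) = inj₂ (inj₂ v≡x2)
          decide (no  v≢x0) (no  v≢x1) (no  v≢x2) =
            ⊥-elim (true≢false (trans (sym (U-∈ Sv v≢x0 v≢x1 v≢x2)) Uv))

        U-x0 : U x0 ≡ false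
        U-x0 = cong (_∧ not (x0 == x2)) T-x0

        U-x1 : U x1 ≡ false
        U-x1 = cong (_∧ not (x1 == x2)) T-x1

        U-x2 : U x2 ≡ false
        U-x2 = ∖-∉ T x2

        conn-U : ConnectedIn U
        conn-U = remove-pendant-connected conn-T (pendant-by-elimination T⊆S x2-nbrs T-x1)

        count-S′ : count S ≡ 3 + count U
        count-S′ = trans count-S (cong (2 +_) (count-remove T T-x2))
          where T-x2 = T-∈ S-x2 (x0≢x2 ∘ sym) (x1≢x2 ∘ sym)

        2≤U : 2 ≤ count U
        2≤U = two-∈⇒2≤count U (~⇒≢ x3~z) (U-∈ S-x3 x3≢x0 x3≢x1 (x2≢x3 ∘ sym))
                                           (U-∈ S-z z≢x0 z≢x1 z≢x2)
          where
          z≢x0 : ¬ z ≡ x0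
          z≢x0 z≡x0 = x3≢x1 (x0-pendant S-x3 (~-sym (subst (x3 ~_) z≡x0 x3~z)))
          z≢x1 : ¬ z ≡ x1
          z≢x1 z≡x1 = [ x2≢x3 ∘ sym , x3≢x0 ] (x1-nbrs S-x3 (~-sym (subst (x3 ~_) z≡x1 x3~z)))

        module _ {D} (perfect : PerfectIn U D) (half : 2 * count D ≤ count U) where

          D⊆U : D ⊆ U
          D⊆U = proj₁ perfect

          bound : 3 + 2 * count D ≤ count S
          bound = ≤-trans (+-monoʳ-≤ 3 half) (≤-reflexive (sym count-S′))

          via-x0 : D x3 ≡ true → SmallPerfect S
          via-x0 Dx3 = insert-small-perfect U⊆S perfect S-x0 (⊆-∉ {D = D} D⊆U U-x0)
                         (λ Uv _ → ¬~x0 (U⊆S Uv) (U-≢x1 Uv)) outside bound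
            where
            I⊆S = insert-⊆ {D = D} (U⊆S ∘ D⊆U) S-x0
            outside : ∀ {v} → S v ≡ true → U v ≡ false → ¬ v ≡ x0 → degree (insert x0 D) v ≡ 1
            outside Sv Uv v≢x0 with U-∉ Sv Uv
            ... | inj₁ refl        = ⊥-elim (v≢x0 refl)
            ... | inj₂ (inj₁ refl) = pendant⇒degree≡1 (insert-∈ x0 D) x1~x0
                                       (pendant-by-elimination I⊆S x1-nbrs
                                          (insert-∉ {D = D} (⊆-∉ {D = D} D⊆U U-x2) (x0≢x2 ∘ sym)))
            ... | inj₂ (inj₂ refl) = pendant⇒degree≡1 (insert-⊇ {D = D} Dx3) x2~x3
                                       (pendant-by-elimination I⊆S x2-nbrs
                                          (insert-∉ {D = D} (⊆-∉ {D = D} D⊆U U-x1) (~⇒≢ x1~x0)))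

          via-x1 : D x3 ≡ false → SmallPerfect S
          via-x1 Dx3 = insert-small-perfect U⊆S perfect S-x1 (⊆-∉ {D = D} D⊆U U-x1)
                         (λ Uv _ → ¬~x1 (U⊆S Uv) (U-≢x2 Uv) (U-≢x0 Uv)) outside bound
            where
            I⊆S = insert-⊆ {D = D} (U⊆S ∘ D⊆U) S-x1
            outside : ∀ {v} → S v ≡ true → U v ≡ false → ¬ v ≡ x1 → degree (insert x1 D) v ≡ 1
            outside Sv Uv v≢x1 with U-∉ Sv Uv
            ... | inj₁ refl        = pendant⇒degree≡1 (insert-∈ x1 D) x0~x1 (x0-pendant ∘ I⊆S)
            ... | inj₂ (inj₁ refl) = ⊥-elim (v≢x1 refl)
            ... | inj₂ (inj₂ refl) = pendant⇒degree≡1 (insert-∈ x1 D) (~-sym x1~x2)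
                                       (pendant-by-elimination I⊆S (λ Sy x2~y → Sum.swap (x2-nbrs Sy x2~y))
                                          (insert-∉ {D = D} Dx3 x3≢x1))

        small : SmallPerfect S
        small with half-perfect conn-U 2≤U
                     (ih (subst (count U <_) (sym count-S′) (≤-trans (n≤1+n _) (n≤1+n _))) conn-U 2≤U)
        ... | D , perfect , half with D x3 in Dx3
        ...   | true  = via-x0 perfect half Dx3
        ...   | false = via-x1 perfect half Dx3

    long-path-end-dichotomy : CoronaOrSmall S
    long-path-end-dichotomy with neighbours⊆₂? S x1 x2 x0
    ... | inj₁ (y , Sy , x1~y , y≢x2 , y≢x0) = inj₂ (SecondLeafAtX1.small Sy x1~y y≢x2 y≢x0)
    ... | inj₂ x1-nbrs with neighbours⊆₂? S x2 x1 x3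
    ...   | inj₁ (z , Sz , x2~z , z≢x1 , z≢x3) = X2OfHighDegree.result x1-nbrs Sz x2~z z≢x1 z≢x3
    ...   | inj₂ x2-nbrs with pendant? S x3 x2
    ...     | inj₁ (z , Sz , x3~z , z≢x2) = inj₂ (X2OfDegreeTwo.small x1-nbrs x2-nbrs Sz x3~z z≢x2)
    ...     | inj₂ x3-pendant =
      inj₁ (X2OfDegreeTwo.path-corona-like x1-nbrs x2-nbrs x3-pendant)

  dichotomy-step : ∀ {S} → ConnectedIn S → 2 ≤ count S → Smaller S → CoronaOrSmall S
  dichotomy-step {S} conn 2≤ ih with m≤n⇒m<n∨m≡n 2≤
  ... | inj₂ 2≡ = inj₁ (pair-corona-like conn (sym 2≡))
  ... | inj₁ 3≤ with star-or-end S conn 2≤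
  ...   | inj₁ (c , Sc , spokes) =
    inj₂ ((_== c) , centre-perfect Sc spokes ,
          subst (λ k → 2 * k < count S) (sym (count-singleton c)) 3≤)
  ...   | inj₂ p = long-path-end-dichotomy conn ih p

  dichotomy : ∀ {S} → ConnectedIn S → 2 ≤ count S → CoronaOrSmall S
  dichotomy {S} =
    <-rec (λ m → ∀ {S} → count S ≡ m → ConnectedIn S → 2 ≤ count S → CoronaOrSmall S)
          (λ _ rec eq conn 2≤ → dichotomy-step conn 2≤ λ T<S → rec (subst (_ <_) eq T<S) refl)
          (count S) refl

-- Recognising coronas

induced : ∀ {n k} → Graph n → (Fin k → Fin n) → Graph k
induced G f = record
  { adj    = λ i j → adj G (f i) (f j)
  ; symm   = λ i j → symm G (f i) (f j)
  ; irrefl = λ i → irrefl G (f i)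
  }

induced-acyclic : ∀ {n k} (G : Graph n) {f : Fin k → Fin n} → (∀ {i j} → f i ≡ f j → i ≡ j) →
  Acyclic G → Acyclic (induced G f)
induced-acyclic G {f} f-injective acyclic (u , vs , 2≤ , uniq , linked) =
  acyclic (f u , map f vs , subst (2 ≤_) (sym (length-map f vs)) 2≤ , Uniqueₚ.map⁺ f-injective uniq ,
           subst (λ zs → Linked (Adj G) (f u ∷ zs)) (map-++ f vs (u ∷ [])) (Linkedₚ.map⁺ linked))

induced-connected : ∀ {n} (G : Graph n) (S : VertexSet n) →
  Neighbourhood.ConnectedIn G S → Connected (induced G (enum S))
induced-connected G S conn i j =
  subst₂ (Walk (induced G (enum S))) (index-enum S i _) (index-enum S j _)
    (lift (enum-∈ S i) (conn (enum-∈ S i) (enum-∈ S j)) (enum-∈ S j))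
  where
  open Neighbourhood G
  lift : ∀ {a b} (Sa : S a ≡ true) → WalkIn S a b → (Sb : S b ≡ true) →
    Walk (induced G (enum S)) (index S a Sa) (index S b Sb)
  lift {a} Sa here Sb = subst (λ h → Walk _ (index S a Sa) (index S a h)) (true-irrelevant Sa Sb) here
  lift Sa (step {v = v} a~v Sv rest) Sb =
    step (subst₂ (Adj G) (sym (enum-index S _ Sa)) (sym (enum-index S v Sv)) a~v) (lift Sv rest Sb)

module CoronaRecognition {n : ℕ} (T : Graph n) (acyclic : Acyclic T) where
  open Neighbourhood T
  open PerfectSets T

  module _ (conn : ConnectedIn full) (3≤n : 3 ≤ n) (corona : CoronaLike full) where

    leaf : VertexSet n
    leaf = isLeaf full

    inner : VertexSet n
    inner v = not (leaf v)

    k : ℕ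
    k = count inner

    core : Fin k → Fin n
    core = enum inner

    H : Graph k
    H = induced T core

    leafAt : Fin n → Fin n
    leafAt c with find (nbr (leaves full) c)
    ... | inj₁ (w , _) = w
    ... | inj₂ _       = c

    one-leaf : ∀ {c} → inner c ≡ true → degree (leaves full) c ≡ 1
    one-leaf {c} c-inner with corona {c} refl
    ... | inj₁ c-leaf = ⊥-elim (true≢false (trans (sym c-leaf) (not-true c-inner)))
    ... | inj₂ one    = one

    leafAt-spec : ∀ {c} → inner c ≡ true → c ~ leafAt c × leaf (leafAt c) ≡ true
    leafAt-spec {c} c-inner with find (nbr (leaves full) c)
    ... | inj₁ (w , h) = ∧-elimʳ {leaf w} h , ∧-elimˡ h
    ... | inj₂ none with () ← trans (sym (count-none none)) (one-leaf c-inner)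

    leafAt-unique : ∀ {c y} → inner c ≡ true → c ~ y → leaf y ≡ true → y ≡ leafAt c
    leafAt-unique c-inner c~y y-leaf =
      count≡1⇒unique _ (one-leaf c-inner) (∧-intro y-leaf c~y)
        (∧-intro (proj₂ (leafAt-spec c-inner)) (proj₁ (leafAt-spec c-inner)))

    partner-inner : ∀ {v} → leaf v ≡ true → inner (partner full v) ≡ true
    partner-inner {v} v-leaf with leaf (partner full v) in w-leaf
    ... | false = refl
    ... | true  = ⊥-elim (<⇒≱ (subst (3 ≤_) (sym (count-true n)) 3≤n)
                              (leaf-pair⇒count≤2 conn refl v-leaf w-leaf))

    leaf-nbr-inner : ∀ {v w} → leaf v ≡ true → v ~ w → inner w ≡ true
    leaf-nbr-inner v-leaf v~w rewrite partner-pendant v-leaf refl v~w = partner-inner v-leaf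

    partner-leafAt : ∀ {c} → inner c ≡ true → partner full (leafAt c) ≡ c
    partner-leafAt c-inner with leafAt-spec c-inner
    ... | c~l , l-leaf = sym (partner-pendant l-leaf refl (~-sym c~l))

    leafAt-partner : ∀ {v} → leaf v ≡ true → leafAt (partner full v) ≡ v
    leafAt-partner v-leaf = sym (leafAt-unique (partner-inner v-leaf) (~-sym (partner-~ v-leaf)) v-leaf)

    -- Inner vertices form the first copy of the core, leaves the second, each labelled by its partner.
    side : ∀ v b → leaf v ≡ b → Fin k ⊎ Fin k
    side v false v-inner = inj₁ (index inner v (false⇒not v-inner))
    side v true  v-leaf  = inj₂ (index inner (partner full v) (partner-inner v-leaf))

    to : Fin n → Fin k ⊎ Fin k
    to v = side v (leaf v) refl

    from : Fin k ⊎ Fin k → Fin n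
    from (inj₁ i) = core i
    from (inj₂ i) = leafAt (core i)

    from-to : ∀ v → from (to v) ≡ v
    from-to v = go (leaf v) refl
      where
      go : ∀ b (e : leaf v ≡ b) → from (side v b e) ≡ v
      go false v-inner = enum-index inner v _
      go true  v-leaf  = trans (cong leafAt (enum-index inner _ _)) (leafAt-partner v-leaf)

    to-from : ∀ x → to (from x) ≡ x
    to-from (inj₁ i) = go (leaf (core i)) refl
      where
      go : ∀ b (e : leaf (core i) ≡ b) → side (core i) b e ≡ inj₁ i
      go false _      = cong inj₁ (index-enum inner i _)
      go true  i-leaf = ⊥-elim (true≢false (trans (sym i-leaf) (not-true (enum-∈ inner i))))
    to-from (inj₂ i) = go (leaf (leafAt (core i))) refl
      where
      go : ∀ b (e : leaf (leafAt (core i)) ≡ b) → side (leafAt (core i)) b e ≡ inj₂ i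
      go false l-inner = ⊥-elim (true≢false (trans (sym (proj₂ (leafAt-spec (enum-∈ inner i)))) l-inner))
      go true  _       =
        cong inj₂ (trans (index-cong inner (partner-leafAt (enum-∈ inner i)) _ (enum-∈ inner i))
                         (index-enum inner i _))

    iso : Fin n ↔ Fin (k + k)
    iso = mk↔ₛ′ (join k k ∘ to) (from ∘ splitAt k)
      (λ j → trans (cong (join k k) (to-from (splitAt k j))) (join-splitAt k k j))
      (λ v → trans (cong from (splitAt-join k k (to v))) (from-to v))

    adj-preserved : ∀ u v → adj T u v ≡ coronaAdj⊎ H (to u) (to v)
    adj-preserved u v = go (leaf u) refl (leaf v) refl
      where
      go : ∀ bu (eu : leaf u ≡ bu) bv (ev : leaf v ≡ bv) →
        adj T u v ≡ coronaAdj⊎ H (side u bu eu) (side v bv ev)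
      go false eu false ev = sym (cong₂ (adj T) (enum-index inner u _) (enum-index inner v _))
      go false eu true  ev with index inner u (false⇒not eu) ≟ index inner (partner full v) (partner-inner ev)
      ... | yes eq rewrite index-injective inner _ _ eq = ~-sym (partner-~ ev)
      ... | no  ne = ¬true⇒false λ u~v → ne (index-cong inner (partner-pendant ev refl (~-sym u~v)) _ _)
      go true  eu false ev with index inner (partner full u) (partner-inner eu) ≟ index inner v (false⇒not ev)
      ... | yes eq rewrite sym (index-injective inner _ _ eq) = partner-~ eu
      ... | no  ne = ¬true⇒false λ u~v → ne (index-cong inner (sym (partner-pendant eu refl u~v)) _ _)
      go true  eu true  ev =
        ¬true⇒false λ u~v → true≢false (trans (sym (leaf-nbr-inner eu u~v)) (cong not ev))

    H-connected : Connected H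
    H-connected =
      induced-connected T inner (prune-connected conn λ _ v-leaf → partner full _ , partner-pendant v-leaf)

    1≤k : 1 ≤ k
    1≤k with 1≤count⇒∈ full (subst (1 ≤_) (sym (count-true n)) (≤-trans (s≤s z≤n) 3≤n))
    ... | v , _ with leaf v in v-leaf
    ... | false = ∈⇒1≤count inner (false⇒not v-leaf)
    ... | true  = ∈⇒1≤count inner (partner-inner v-leaf)

    corona-of-tree : IsCoronaOfTree T
    corona-of-tree =
      k , H , (1≤k , H-connected , induced-acyclic T (enum-injective inner) acyclic) , iso ,
      λ u v → trans (adj-preserved u v)
                    (sym (cong₂ (coronaAdj⊎ H) (splitAt-join k k (to u)) (splitAt-join k k (to v))))

K₂-corona : (G : Graph 2) → Connected G → IsCoronaOfTree G
K₂-corona G conn =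
  1 , K₁ , (s≤s z≤n , (λ { zero zero → here }) , K₁-acyclic) ,
  mk↔ₛ′ id id (λ _ → refl) (λ _ → refl) , adj-preserved
  where
  K₁ : Graph 1
  K₁ = record { adj = λ _ _ → false ; symm = λ _ _ → refl ; irrefl = λ _ → refl }
  K₁-acyclic : Acyclic K₁
  K₁-acyclic (_ , []    , () , _)
  K₁-acyclic (_ , _ ∷ _ , _  , _ , () ∷ _)
  edge : adj G zero (suc zero) ≡ true
  edge with conn zero (suc zero)
  ... | step {v = zero}     0~0 _ with () ← trans (sym (irrefl G zero)) 0~0
  ... | step {v = suc zero} 0~1 _ = 0~1
  adj-preserved : ∀ u v → adj G u v ≡ adj (corona K₁) u v
  adj-preserved zero       zero       = irrefl G zero
  adj-preserved zero       (suc zero) = edge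
  adj-preserved (suc zero) zero       = trans (symm G (suc zero) zero) edge
  adj-preserved (suc zero) (suc zero) = irrefl G (suc zero)

corona-like⇒corona : ∀ {n} (T : Graph n) → Connected T → Acyclic T → 2 ≤ n →
  PerfectSets.CoronaLike T (Neighbourhood.full T) → IsCoronaOfTree T
corona-like⇒corona {suc zero}          T conn acyclic (s≤s ()) _
corona-like⇒corona {suc (suc zero)}    T conn acyclic _ _ = K₂-corona T conn
corona-like⇒corona {suc (suc (suc _))} T conn acyclic _ corona-like =
  CoronaRecognition.corona-of-tree T acyclic (Neighbourhood.Connected⇒ConnectedIn-full T conn)
    (s≤s (s≤s (s≤s z≤n))) corona-like

-- A pendant vertex of a corona is dominated only by itself or its hub, so picking one of the two
-- for every hub injects the k hubs into any dominating set.
module CoronaDomination {n k} (G : Graph n) (H : Graph k) (f : Fin n ↔ Fin (k + k))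
                        (adj-preserved : ∀ u v → adj G u v ≡ adj (corona H) (Inverse.to f u) (Inverse.to f v))
                        (D : Subset n) (dominating : IsDominating G D) where
  open Inverse f using (to; from; strictlyInverseˡ; strictlyInverseʳ)

  n≡k+k : n ≡ k + k
  n≡k+k = cantor-schröder-bernstein
    (λ {x} {y} e → trans (sym (strictlyInverseʳ x)) (trans (cong from e) (strictlyInverseʳ y)))
    (λ {x} {y} e → trans (sym (strictlyInverseˡ x)) (trans (cong to e) (strictlyInverseˡ y)))

  side : Fin n → Fin k ⊎ Fin k
  side x = splitAt k (to x)

  vertex : Fin k ⊎ Fin k → Fin n
  vertex s = from (join k k s)

  side-vertex : ∀ s → side (vertex s) ≡ s
  side-vertex s = trans (cong (splitAt k) (strictlyInverseˡ _)) (splitAt-join k k s)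

  vertex-side : ∀ x → vertex (side x) ≡ x
  vertex-side x = trans (cong from (join-splitAt k k (to x))) (strictlyInverseʳ x)

  pendant-nbr : ∀ {i u} → Adj G (vertex (inj₂ i)) u → side u ≡ inj₁ i
  pendant-nbr {i} {u} i~u = go (side u) (trans (sym adj-eq) i~u)
    where
    adj-eq : adj G (vertex (inj₂ i)) u ≡ coronaAdj⊎ H (inj₂ i) (side u)
    adj-eq = trans (adj-preserved _ u) (cong (λ s → coronaAdj⊎ H s (side u)) (side-vertex (inj₂ i)))
    go : ∀ s → coronaAdj⊎ H (inj₂ i) s ≡ true → s ≡ inj₁ i
    go (inj₁ j) h with i ≟ j
    ... | yes refl = refl
    go (inj₂ j) ()

  chosen : Fin k → Fin n
  chosen i with lookup D (vertex (inj₂ i))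
  ... | true  = vertex (inj₂ i)
  ... | false = vertex (inj₁ i)

  chosen-∈ : ∀ i → lookup D (chosen i) ≡ true
  chosen-∈ i with lookup D (vertex (inj₂ i)) in pendant∈
  ... | true  = pendant∈
  ... | false with dominating (vertex (inj₂ i)) (λ m → true≢false (trans (sym ([]=⇒lookup m)) pendant∈))
  ...   | u , u∈D , i~u =
    subst (λ x → lookup D x ≡ true) (trans (sym (vertex-side u)) (cong vertex (pendant-nbr i~u)))
          ([]=⇒lookup u∈D)

  chosen-side : ∀ i → side (chosen i) ≡ inj₂ i ⊎ side (chosen i) ≡ inj₁ i
  chosen-side i with lookup D (vertex (inj₂ i))
  ... | true  = inj₁ (side-vertex (inj₂ i))
  ... | false = inj₂ (side-vertex (inj₁ i))

  chosen-injective : ∀ {i j} → chosen i ≡ chosen j → i ≡ j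
  chosen-injective {i} {j} e with chosen-side i | chosen-side j
  ... | inj₁ p | inj₁ q = Sumₚ.inj₂-injective (trans (sym p) (trans (cong side e) q))
  ... | inj₂ p | inj₂ q = Sumₚ.inj₁-injective (trans (sym p) (trans (cong side e) q))
  ... | inj₁ p | inj₂ q with () ← trans (sym p) (trans (cong side e) q)
  ... | inj₂ p | inj₁ q with () ← trans (sym p) (trans (cong side e) q)

  n≤2∣D∣ : n ≤ 2 * ∣ D ∣
  n≤2∣D∣ = subst₂ _≤_ (sym n≡k+k) (cong (∣ D ∣ +_) (sym (+-identityʳ ∣ D ∣))) (+-mono-≤ k≤∣D∣ k≤∣D∣)
    where
    k≤∣D∣ : k ≤ ∣ D ∣
    k≤∣D∣ = subst (k ≤_) (trans (sym (∣tabulate∣≡count (lookup D))) (cong ∣_∣ (tabulate∘lookup D)))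
                  (injection⇒≤count (lookup D) chosen chosen-∈ chosen-injective)

corona-domination : ∀ {n} (G : Graph n) → IsCoronaOfTree G → ∀ D → IsDominating G D → n ≤ 2 * ∣ D ∣
corona-domination G (_ , H , _ , f , adj-preserved) D dominating =
  CoronaDomination.n≤2∣D∣ G H f adj-preserved D dominating

-- Fair domination in trees

perfect⇒FD : ∀ {n} (G : Graph n) (D : VertexSet n) →
  PerfectSets.PerfectIn G (Neighbourhood.full G) D → IsFDSet G (tabulate D)
perfect⇒FD G D (_ , perfect) = 1 , ≤-refl , dominating , fair
  where
  open Neighbourhood G
  ∈D : ∀ {v} → D v ≡ true → v ∈ tabulate D
  ∈D {v} Dv = lookup⇒[]= v (tabulate D) (trans (lookup∘tabulate D v) Dv)
  ∉D : ∀ {v} → v ∉ tabulate D → D v ≡ false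
  ∉D v∉ = ¬true⇒false (v∉ ∘ ∈D)
  nbrsIn≡degree : ∀ v → nbrsIn G (tabulate D) v ≡ degree D v
  nbrsIn≡degree v = trans (∣tabulate∣≡count (λ u → adj G v u ∧ lookup (tabulate D) u))
    (count-cong λ u → trans (cong (adj G v u ∧_) (lookup∘tabulate D u)) (Bool.∧-comm (adj G v u) (D u)))
  fair : ∀ v → v ∉ tabulate D → nbrsIn G (tabulate D) v ≡ 1
  fair v v∉ = trans (nbrsIn≡degree v) (perfect refl (∉D v∉))
  dominating : IsDominating G (tabulate D)
  dominating v v∉ with 1≤count⇒∈ (nbr D v) (≤-reflexive (sym (perfect refl (∉D v∉))))
  ... | u , h = u , ∈D (∧-elimˡ h) , ∧-elimʳ {D u} h

corollary2 : ∀ {n} (T : Graph n) → IsTree T → 2 ≤ n →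
    ∀ m → IsFd T m → (2 * m ≤ n) × ((2 * m ≡ n) ⇔ IsCoronaOfTree T)
corollary2 {n} T (_ , connected , acyclic) 2≤n m ((D₀ , (_ , _ , D₀-dominating , _) , ∣D₀∣≡m) , minimal) =
  bound , mk⇔ corona⇐ corona⇒
  where
  open Neighbourhood T
  open PerfectSets T
  open Dichotomy T acyclic
  conn = Connected⇒ConnectedIn-full connected
  2≤ = subst (2 ≤_) (sym (count-true n)) 2≤n
  2m≤ : ∀ {D} → PerfectIn full D → 2 * m ≤ 2 * count D
  2m≤ {D} perfect = *-monoʳ-≤ 2 (subst (m ≤_) (∣tabulate∣≡count D) (minimal _ (perfect⇒FD T D perfect)))
  bound : 2 * m ≤ n
  bound with half-perfect conn 2≤ (dichotomy conn 2≤)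
  ... | D , perfect , half = ≤-trans (2m≤ perfect) (subst (2 * count D ≤_) (count-true n) half)
  corona⇐ : 2 * m ≡ n → IsCoronaOfTree T
  corona⇐ 2m≡n with dichotomy conn 2≤
  ... | inj₁ corona-like           = corona-like⇒corona T connected acyclic 2≤n corona-like
  ... | inj₂ (D , perfect , small) =
    ⊥-elim (<⇒≱ (subst (2 * count D <_) (trans (count-true n) (sym 2m≡n)) small) (2m≤ perfect))
  corona⇒ : IsCoronaOfTree T → 2 * m ≡ n
  corona⇒ is-corona =
    ≤-antisym bound (subst (λ c → n ≤ 2 * c) ∣D₀∣≡m (corona-domination T is-corona D₀ D₀-dominating))
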